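{- For the path $P_n$ ($n\ge1$) and all positive integers $i,j$, $$(F_{P_n}(q))_{i,j}=\sum_{\substack{\alpha\vDash n+j-i-1\\ \alpha_\ell\ge j}}([\alpha_1]_q-1)\cdots([\alpha_\ell]_q-1)\,e_{\mathrm{sort}(\alpha)},$$ where $\ell=\ell(\alpha)$; when $i=n+j-1$ the empty composition is included and contributes $1$ (so $(F_{P_n}(q))_{n+j-1,j}=1$), and the sum is empty (zero) when $n+j-i-1<0$.
   Context: $P_n$ is the path on $[n]$ with edges $\{i,i+1\}$; it is a natural unit interval graph. $\alpha\vDash m$ means $\alpha$ is a composition of $m$; $\mathrm{sort}(\alpha)$ is the partition obtained by sorting its parts; $e_\lambda$ are elementary symmetric functions; $[k]_q=1+q+\dots+q^{k-1}$. For $G$ on $[n]$, $G+P_j$ is the graph on $[n+j-1]$ obtained by adding edges $\{n,n+1\},\dots,\{n+j-2,n+j-1\}$. Edges are ordered lexicographically ($\{a,b\}\lessdot\{a',b'\}$, $a<b$, $a'<b'$, iff $a<a'$ or $a=a'$, $b<b'$). NBC tree: a subtree (single vertex allowed) in which no vertex has two $T$-neighbours larger than itself. Tree triple $(T,\alpha,r)$: $T$ NBC tree, $\alpha$ composition of $|V(T)|$, $1\le r\le\alpha_1$. Forest triple: sequence of tree triples $(T_k,\alpha^{(k)},r_k)_{k=1}^m$ partitioning the vertices with $\min T_1<\dots<\min T_m$; sign $(-1)^{\sum(\ell(\alpha^{(k)})-1)}$; type = sorted concatenation; $\mathrm{type}'$ = type minus one instance of $\alpha^{(1)}_1$. $\mathrm{list}(T)$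 reads $\min T$ then repeatedly the smallest unread vertex of $T$ adjacent in $T$ to a read one; $\mathrm{inv}_G(\sigma)=|\{(a,b):a<b,\sigma_a>\sigma_b,\{\sigma_b,\sigma_a\}\in E(G)\}|$; $\mathrm{weight}=\mathrm{inv}(\mathrm{list}(T_1)\cdots\mathrm{list}(T_m))+\sum(r_k-1)$. $\mathrm{FT}^{(i)}(G+P_j)$: forest triples of $G+P_j$ such that, with $(T,\alpha,r)$ containing $1$ and $(T',\alpha',r')$ containing $n$ (possibly equal), $\alpha_1=i$, $r=1$, $\{n,\dots,n+j-1\}\subseteq V(T')$, last part of $\alpha'\ge j$. $(F_G(q))_{i,j}=\sum_{\mathrm{FT}^{(i)}(G+P_j)}\mathrm{sign}\,q^{\mathrm{weight}}e_{\mathrm{type}'}$ (weight computed in $G+P_j$). -}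

module Defs where

open import Data.Bool using (Bool; true; false; _∧_; _∨_; not; if_then_else_)
open import Data.Nat using (ℕ; zero; suc; _+_; _∸_; _≡ᵇ_; _<ᵇ_; _≤ᵇ_; _⊓_)
open import Data.Integer using (ℤ) renaming (+_ to ⁺_; _+_ to _+ℤ_; _*_ to _*ℤ_; -_ to -ℤ_)
open import Data.List using (List; []; _∷_; _++_; length; map; concat; concatMap; foldr; upTo; replicate)
open import Data.Nat.ListAction using (sum)
open import Data.Maybe using (Maybe; just; nothing)
open import Data.Product using (_×_; _,_; proj₁; proj₂)

filterB : {A : Set} → (A → Bool) → List A → List A
filterB p [] = []
filterB p (x ∷ xs) = if p x then x ∷ filterB p xs else filterB p xs

allB : {A : Set} → (A → Bool) → List A → Bool
allB p [] = true
allB p (x ∷ xs) = p x ∧ allB p xs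

anyB : {A : Set} → (A → Bool) → List A → Bool
anyB p [] = false
anyB p (x ∷ xs) = p x ∨ anyB p xs

countB : {A : Set} → (A → Bool) → List A → ℕ
countB p xs = length (filterB p xs)

-- [lo .. hi] (empty if hi < lo)
range : ℕ → ℕ → List ℕ
range lo hi = map (lo +_) (upTo (suc hi ∸ lo))

elemB : ℕ → List ℕ → Bool
elemB x = anyB (x ≡ᵇ_)

eqList : List ℕ → List ℕ → Bool
eqList [] [] = true
eqList [] (_ ∷ _) = false
eqList (_ ∷ _) [] = false
eqList (x ∷ xs) (y ∷ ys) = (x ≡ᵇ y) ∧ eqList xs ys

sublists : {A : Set} → List A → List (List A)
sublists [] = [] ∷ []
sublists (x ∷ xs) = map (x ∷_) (sublists xs) ++ sublists xs

listsOf : {A : Set} → List A → ℕ → List (List A)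
listsOf xs zero = [] ∷ []
listsOf xs (suc k) = concatMap (λ x → map (x ∷_) (listsOf xs k)) xs

headD : ℕ → List ℕ → ℕ
headD d [] = d
headD d (x ∷ _) = x

lastD : ℕ → List ℕ → ℕ
lastD d [] = d
lastD d (x ∷ xs) = lastD x xs

minL : List ℕ → ℕ
minL [] = 0
minL (x ∷ xs) = foldr _⊓_ x xs

strictlyIncreasing : List ℕ → Bool
strictlyIncreasing [] = true
strictlyIncreasing (x ∷ []) = true
strictlyIncreasing (x ∷ y ∷ ys) = (x <ᵇ y) ∧ strictlyIncreasing (y ∷ ys)

-- insertion sort into weakly decreasing order (partitions are weakly decreasing lists)
insertDesc : ℕ → List ℕ → List ℕ
insertDesc x [] = x ∷ []
insertDesc x (y ∷ ys) = if y ≤ᵇ x then x ∷ y ∷ ys else y ∷ insertDesc x ys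

sortDesc : List ℕ → List ℕ
sortDesc = foldr insertDesc []

removeOne : ℕ → List ℕ → List ℕ
removeOne x [] = []
removeOne x (y ∷ ys) = if x ≡ᵇ y then ys else y ∷ removeOne x ys

compositions : ℕ → List (List ℕ)
compositions m = filterB (λ α → sum α ≡ᵇ m) (concatMap (listsOf (range 1 m)) (range 0 m))

-- Polynomials in q with integer coefficients: coefficient lists (constant first)

Poly : Set
Poly = List ℤ

polyAdd : Poly → Poly → Poly
polyAdd [] q = q
polyAdd (a ∷ p) [] = a ∷ p
polyAdd (a ∷ p) (b ∷ q) = (a +ℤ b) ∷ polyAdd p q

polyMul : Poly → Poly → Poly
polyMul [] q = []
polyMul (a ∷ p) q = polyAdd (map (a *ℤ_) q) (⁺ 0 ∷ polyMul p q)

coeffAt : ℕ → Poly → ℤ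
coeffAt k [] = ⁺ 0
coeffAt zero (a ∷ p) = a
coeffAt (suc k) (a ∷ p) = coeffAt k p

monomial : ℤ → ℕ → Poly
monomial c k = replicate k (⁺ 0) ++ (c ∷ [])

qint : ℕ → Poly
qint a = replicate a (⁺ 1)

qintMinus1 : ℕ → Poly
qintMinus1 a = polyAdd (qint a) (-ℤ (⁺ 1) ∷ [])

negOnePow : ℕ → ℤ
negOnePow zero = ⁺ 1
negOnePow (suc k) = -ℤ (negOnePow k)

-- Elements of Λ[q] written in the e-basis: formal sums  Σ p_t(q) e_{λ_t}.
-- Since the e_λ form a basis, two such elements are equal iff all
-- coefficients [q^k e_λ] agree.

SymE : Set
SymE = List (Poly × List ℕ)

coeffE : SymE → List ℕ → ℕ → ℤ
coeffE terms μ k =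
  foldr _+ℤ_ (⁺ 0)
    (map (λ tm → if eqList (proj₂ tm) μ then coeffAt k (proj₁ tm) else ⁺ 0) terms)

-- Graphs on vertex set [N] = {1,..,N}.
-- A graph is given by  G a b  (queried for a < b): is {a,b} an edge.

Graph : Set
Graph = ℕ → ℕ → Bool

pathGraph : ℕ → Graph
pathGraph n a b = (suc a ≡ᵇ b) ∧ (1 ≤ᵇ a) ∧ (b ≤ᵇ n)

plusPath : Graph → ℕ → ℕ → Graph
plusPath G n j a b = G a b ∨ ((suc a ≡ᵇ b) ∧ (n ≤ᵇ a) ∧ (b ≤ᵇ n + j ∸ 1))

edgesOf : Graph → ℕ → List (ℕ × ℕ)
edgesOf G N = concatMap (λ a → map (a ,_) (filterB (G a) (range (suc a) N))) (range 1 N)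

-- Tree triples (T, α, r); T given by its vertex set (increasing list) and
-- its edge set (lex-ordered sublist of E(G)).

record TreeTriple : Set where
  constructor treeTriple
  field
    verts : List ℕ
    edges : List (ℕ × ℕ)
    comp  : List ℕ
    rr    : ℕ
open TreeTriple public

edgeIn : List (ℕ × ℕ) → ℕ → ℕ → Bool
edgeIn Ed u v = anyB (λ e → ((proj₁ e ≡ᵇ u) ∧ (proj₂ e ≡ᵇ v)) ∨ ((proj₁ e ≡ᵇ v) ∧ (proj₂ e ≡ᵇ u))) Ed

-- list(T): read min T, then repeatedly the smallest unread vertex adjacent in T
-- to a read one (stops when no such vertex exists)
listGo : List ℕ → List (ℕ × ℕ) → ℕ → List ℕ → List ℕ
listGo V Ed zero read = read
listGo V Ed (suc f) read with filterB (λ v → not (elemB v read) ∧ anyB (edgeIn Ed v) read) V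
... | [] = read
... | c ∷ cs = listGo V Ed f (read ++ (minL (c ∷ cs) ∷ []))

listT : TreeTriple → List ℕ
listT t = listGo (verts t) (edges t) (length (verts t)) (minL (verts t) ∷ [])

-- T is a tree with vertex set V and edge set Ed contained in E(G):
-- every edge is an edge of G between vertices of V, T is connected
-- (every vertex is reached from min T), and |E(T)| = |V(T)| - 1.
isTree : Graph → TreeTriple → Bool
isTree G t =
  anyB (λ _ → true) (verts t)
  ∧ allB (λ e → (proj₁ e <ᵇ proj₂ e) ∧ G (proj₁ e) (proj₂ e)
                ∧ elemB (proj₁ e) (verts t) ∧ elemB (proj₂ e) (verts t)) (edges t)
  ∧ allB (λ v → elemB v (listT t)) (verts t)
  ∧ (suc (length (edges t)) ≡ᵇ length (verts t))

-- NBC: no vertex has two T-neighbours larger than itself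
isNBC : TreeTriple → Bool
isNBC t = allB (λ v → countB (λ u → (v <ᵇ u) ∧ edgeIn (edges t) v u) (verts t) ≤ᵇ 1) (verts t)

isTreeTriple : Graph → TreeTriple → Bool
isTreeTriple G t =
  isTree G t ∧ isNBC t
  ∧ allB (1 ≤ᵇ_) (comp t) ∧ (sum (comp t) ≡ᵇ length (verts t))
  ∧ (1 ≤ᵇ rr t) ∧ (rr t ≤ᵇ headD 0 (comp t))

treeTriples : Graph → ℕ → List TreeTriple
treeTriples G N =
  filterB (isTreeTriple G)
    (concatMap (λ V →
      concatMap (λ Ed →
        concatMap (λ α →
          map (λ r → treeTriple V Ed α r) (range 1 (headD 0 α)))
        (compositions (length V)))
      (sublists (edgesOf G N)))
    (sublists (range 1 N)))

allVerts : List TreeTriple → List ℕ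
allVerts ts = concatMap verts ts

isForest : ℕ → List TreeTriple → Bool
isForest N ts =
  allB (λ v → countB (v ≡ᵇ_) (allVerts ts) ≡ᵇ 1) (range 1 N)
  ∧ allB (λ v → (1 ≤ᵇ v) ∧ (v ≤ᵇ N)) (allVerts ts)
  ∧ strictlyIncreasing (map (λ t → minL (verts t)) ts)

forestTriples : Graph → ℕ → List (List TreeTriple)
forestTriples G N =
  filterB (isForest N) (concatMap (listsOf (treeTriples G N)) (range 0 N))

invG : Graph → List ℕ → ℕ
invG G [] = 0
invG G (x ∷ xs) = countB (λ y → (y <ᵇ x) ∧ G y x) xs + invG G xs

weight : Graph → List TreeTriple → ℕ
weight G ts = invG G (concatMap listT ts) + sum (map (λ t → rr t ∸ 1) ts)

sign : List TreeTriple → ℤ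
sign ts = negOnePow (sum (map (λ t → length (comp t) ∸ 1) ts))

type : List TreeTriple → List ℕ
type ts = sortDesc (concatMap comp ts)

type′ : List TreeTriple → List ℕ
type′ [] = type []
type′ (t ∷ ts) = removeOne (headD 0 (comp t)) (type (t ∷ ts))

findTree : ℕ → List TreeTriple → Maybe TreeTriple
findTree v [] = nothing
findTree v (t ∷ ts) = if elemB v (verts t) then just t else findTree v ts

ftCond : ℕ → ℕ → ℕ → List TreeTriple → Bool
ftCond n i j ts = cond1 (findTree 1 ts) ∧ condn (findTree n ts)
  where
  cond1 : Maybe TreeTriple → Bool
  cond1 nothing = false
  cond1 (just t) = (headD 0 (comp t) ≡ᵇ i) ∧ (rr t ≡ᵇ 1)
  condn : Maybe TreeTriple → Bool
  condn nothing = false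
  condn (just t) = allB (λ v → elemB v (verts t)) (range n (n + j ∸ 1))
                   ∧ (j ≤ᵇ lastD 0 (comp t))

FT : Graph → ℕ → ℕ → ℕ → List (List TreeTriple)
FT G n i j = filterB (ftCond n i j) (forestTriples (plusPath G n j) (n + j ∸ 1))

Fentry : Graph → ℕ → ℕ → ℕ → SymE
Fentry G n i j =
  map (λ ts → (monomial (sign ts) (weight (plusPath G n j) ts) , type′ ts)) (FT G n i j)

lastOK : ℕ → List ℕ → Bool
lastOK j [] = true
lastOK j (a ∷ as) = j ≤ᵇ lastD a as

rhsP : ℕ → ℕ → ℕ → SymE
rhsP n i j =
  if i ≤ᵇ n + j ∸ 1
  then map (λ α → (foldr (λ a p → polyMul (qintMinus1 a) p) (⁺ 1 ∷ []) α , sortDesc α))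
           (filterB (lastOK j) (compositions (n + j ∸ 1 ∸ i)))
  else []

{-# OPTIONS --safe #-}
-- P_n + P_j is the path on N = n + j - 1 vertices. Its NBC trees are intervals carrying their path
-- edges, so a forest triple is a tiling of [1, N] by consecutive intervals, together with a
-- composition β of N cut into the compositions of the trees and a root choice r_k for each tree.
-- Reading the trees in order lists 1, 2, ..., N, which has no inversions, so the weight is
-- Σ (r_k - 1). In FT^(i) we have β = i α and r_1 = 1, the conditions on the tree containing n reduce
-- to "the last part of β is at least j", and type′ = sort α. For fixed α, each part a of α either
-- continues the current tree (one more part: sign -1) or starts a new tree with a free root
-- r ∈ [1, a] (factor q^(r-1)); summing gives Π ([a]_q - 1). Since FT^(i) is a filtered enumeration,
-- its sum is computed on an explicit duplicate-free list with the same members.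
module Submission where

open import Defs
open import Data.Bool using (Bool; true; false; T; _∧_; _∨_; not; if_then_else_)
open import Data.Bool.Properties using (T-∧; T-∨; T-≡)
open import Data.Bool.ListAction using (all; any)
open import Data.Empty using (⊥-elim)
open import Data.List using (List; []; _∷_; _++_; length; map; concatMap; foldr; applyUpTo; filterᵇ)
open import Data.List.Properties using (∷-injectiveʳ; length-map; length-++; ++-assoc; ++-identityʳ; map-upTo; filter-++; filter-none)
open import Data.List.Membership.Propositional using (_∈_; _∉_; find; lose)
open import Data.List.Membership.Propositional.Properties
  using (∈-++⁺ˡ; ∈-++⁺ʳ; ∈-++⁻; ∈-map⁺; ∈-map⁻; ∈-concatMap⁺; ∈-concatMap⁻; ∈-filter⁺; ∈-filter⁻)
open import Data.List.Relation.Unary.All as All using (All; []; _∷_)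
import Data.List.Relation.Unary.All.Properties as All
open import Data.List.Relation.Unary.Any as Any using (Any; here; there)
import Data.List.Relation.Unary.Any.Properties as Any
open import Data.List.Relation.Unary.AllPairs as AllPairs using (AllPairs; []; _∷_)
import Data.List.Relation.Unary.AllPairs.Properties as AllPairs
open import Data.List.Relation.Unary.Unique.Propositional using (Unique)
import Data.List.Relation.Unary.Unique.Propositional.Properties as Unique
open import Data.List.Relation.Binary.Sublist.Propositional as Sublist using (_⊆_; []; _∷_; _∷ʳ_)
import Data.List.Relation.Binary.Sublist.Propositional.Properties as Sublist
open import Data.Nat using (ℕ; zero; suc; _+_; _∸_; _≡ᵇ_; _<ᵇ_; _≤ᵇ_; _⊓_; _≤_; _<_; z≤n; s≤s; z<s; _≤?_)
open import Data.Nat.Properties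
open import Data.Nat.ListAction using (sum)
open import Data.Nat.ListAction.Properties using (sum-++)
open import Data.Integer using (ℤ; -_) renaming (+_ to ⁺_; _+_ to _+ℤ_; _*_ to _*ℤ_)
import Data.Integer.Properties as ℤ
open import Data.Integer.Tactic.RingSolver using (solve-∀)
open import Algebra.Bundles using (CommutativeMonoid)
open import Data.List.Relation.Binary.Permutation.Propositional using (_↭_; ↭⇒↭ₛ)
import Data.List.Relation.Binary.Permutation.Propositional.Properties as ↭
open import Data.List.Relation.Binary.Permutation.Setoid.Properties using (foldr-commMonoid)
open import Data.List.Relation.Binary.BagAndSetEquality using (∼bag⇒↭)
open import Data.List.Membership.Propositional.Properties.WithK using (unique∧set⇒bag)
open import Data.Maybe using (Maybe; just; nothing)
open import Data.Product using (_×_; _,_; proj₁; proj₂; ∃-syntax)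
open import Data.Sum using (_⊎_; inj₁; inj₂)
open import Function using (_∘_; Equivalence; mk⇔)
open import Relation.Binary.PropositionalEquality
open import Relation.Nullary using (¬_; Dec; yes; no)
open import Relation.Nullary.Decidable using (T?)

private
  variable
    A B : Set
    x y : A
    xs ys : List A

module _ (p : A → Bool) where

  filterB≡filterᵇ : ∀ xs → filterB p xs ≡ filterᵇ p xs
  filterB≡filterᵇ [] = refl
  filterB≡filterᵇ (x ∷ xs) with p x
  ... | true = cong (x ∷_) (filterB≡filterᵇ xs)
  ... | false = filterB≡filterᵇ xs

  ∈-filterB⁺ : x ∈ xs → T (p x) → x ∈ filterB p xs
  ∈-filterB⁺ {xs = xs} x∈xs px = subst (_ ∈_) (sym (filterB≡filterᵇ xs)) (∈-filter⁺ (T? ∘ p) x∈xs px)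

  ∈-filterB⁻ : ∀ xs → x ∈ filterB p xs → x ∈ xs × T (p x)
  ∈-filterB⁻ xs x∈ = ∈-filter⁻ (T? ∘ p) (subst (_ ∈_) (filterB≡filterᵇ xs) x∈)

  filterB-unique : Unique xs → Unique (filterB p xs)
  filterB-unique {xs = xs} u = subst Unique (sym (filterB≡filterᵇ xs)) (Unique.filter⁺ (T? ∘ p) u)

  filterB-++ : ∀ xs ys → filterB p (xs ++ ys) ≡ filterB p xs ++ filterB p ys
  filterB-++ xs ys rewrite filterB≡filterᵇ (xs ++ ys) | filterB≡filterᵇ xs | filterB≡filterᵇ ys =
    filter-++ (T? ∘ p) xs ys

  filterB-none : All (¬_ ∘ T ∘ p) xs → filterB p xs ≡ []
  filterB-none {xs = xs} none = trans (filterB≡filterᵇ xs) (filter-none (T? ∘ p) none)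

  filterB-accept : T (p x) → filterB p (x ∷ xs) ≡ x ∷ filterB p xs
  filterB-accept {x = x} px with p x
  ... | true = refl

  allB≡all : ∀ xs → allB p xs ≡ all p xs
  allB≡all [] = refl
  allB≡all (x ∷ xs) = cong (p x ∧_) (allB≡all xs)

  allB⁺ : ∀ xs → T (allB p xs) → All (T ∘ p) xs
  allB⁺ xs = All.all⁺ p xs ∘ subst T (allB≡all xs)

  allB⁻ : All (T ∘ p) xs → T (allB p xs)
  allB⁻ {xs = xs} = subst T (sym (allB≡all xs)) ∘ All.all⁻ p

  anyB≡any : ∀ xs → anyB p xs ≡ any p xs
  anyB≡any [] = refl
  anyB≡any (x ∷ xs) = cong (p x ∨_) (anyB≡any xs)

  anyB⁺ : Any (T ∘ p) xs → T (anyB p xs)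
  anyB⁺ {xs = xs} = subst T (sym (anyB≡any xs)) ∘ Any.any⁺ p

  anyB⁻ : ∀ xs → T (anyB p xs) → Any (T ∘ p) xs
  anyB⁻ xs = Any.any⁻ p xs ∘ subst T (anyB≡any xs)

elemB⁺ : {v : ℕ} {vs : List ℕ} → v ∈ vs → T (elemB v vs)
elemB⁺ {v} = anyB⁺ (v ≡ᵇ_) ∘ Any.map (≡⇒≡ᵇ v _)

elemB⁻ : {v : ℕ} (vs : List ℕ) → T (elemB v vs) → v ∈ vs
elemB⁻ {v} vs = Any.map (≡ᵇ⇒≡ v _) ∘ anyB⁻ (v ≡ᵇ_) vs

¬T⇒≡false : ∀ {b} → ¬ T b → b ≡ false
¬T⇒≡false {false} _ = refl
¬T⇒≡false {true} ¬⊤ = ⊥-elim (¬⊤ _)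

∉⇒T-not-elemB : {v : ℕ} (vs : List ℕ) → v ∉ vs → T (not (elemB v vs))
∉⇒T-not-elemB {v} vs v∉vs with elemB v vs in eq
... | true = v∉vs (elemB⁻ vs (subst T (sym eq) _))
... | false = _

∈⇒¬T-not-elemB : {v : ℕ} (vs : List ℕ) → v ∈ vs → ¬ T (not (elemB v vs))
∈⇒¬T-not-elemB {v} vs v∈vs with elemB v vs | elemB⁺ v∈vs
... | true | _ = λ ()

module _ (p : A → Bool) where

  countB-++ : ∀ xs ys → countB p (xs ++ ys) ≡ countB p xs + countB p ys
  countB-++ xs ys = trans (cong length (filterB-++ p xs ys)) (length-++ (filterB p xs))

  countB-none : All (¬_ ∘ T ∘ p) xs → countB p xs ≡ 0
  countB-none none = cong length (filterB-none p none)

  countB>0 : x ∈ xs → T (p x) → 1 ≤ countB p xs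
  countB>0 {xs = xs} x∈xs px with filterB p xs | ∈-filterB⁺ p x∈xs px
  ... | _ ∷ _ | _ = s≤s z≤n

  countB>0⁻ : ∀ xs → 1 ≤ countB p xs → ∃[ x ] (x ∈ xs × T (p x))
  countB>0⁻ xs pos with filterB p xs in eq
  ... | x ∷ _ = x , ∈-filterB⁻ p xs (subst (x ∈_) (sym eq) (here refl))

length≤1 : Unique xs → All (_≡ x) xs → length xs ≤ 1
length≤1 [] _ = z≤n
length≤1 (_ ∷ []) _ = s≤s z≤n
length≤1 ((y≢z ∷ _) ∷ _) (refl ∷ refl ∷ _) = ⊥-elim (y≢z refl)

countB-unique : Unique xs → (p : A → Bool) → All (_≡ x) (filterB p xs) → countB p xs ≤ 1
countB-unique u p = length≤1 (filterB-unique p u)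

multiplicity : ℕ → List ℕ → ℕ
multiplicity v = countB (v ≡ᵇ_)

multiplicity-unique : {v : ℕ} {vs : List ℕ} → Unique vs → v ∈ vs → multiplicity v vs ≡ 1
multiplicity-unique {v} {vs} u v∈vs = ≤-antisym
  (countB-unique u (v ≡ᵇ_) (All.tabulate (λ {w} w∈ → sym (≡ᵇ⇒≡ v w (proj₂ (∈-filterB⁻ _ vs w∈))))))
  (countB>0 (v ≡ᵇ_) v∈vs (≡⇒≡ᵇ v v refl))

multiplicity>0⁻ : ∀ {v} vs → 1 ≤ multiplicity v vs → v ∈ vs
multiplicity>0⁻ {v} vs pos with countB>0⁻ (v ≡ᵇ_) vs pos
... | w , w∈ , v≡ᵇw = subst (_∈ vs) (sym (≡ᵇ⇒≡ v w v≡ᵇw)) w∈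

T-∧⁻ : ∀ a {b} → T (a ∧ b) → T a × T b
T-∧⁻ a = Equivalence.to (T-∧ {a})

T-∧⁺ : ∀ {a b} → T a → T b → T (a ∧ b)
T-∧⁺ ta tb = Equivalence.from T-∧ (ta , tb)

≡ᵇ-refl : ∀ x → (x ≡ᵇ x) ≡ true
≡ᵇ-refl zero = refl
≡ᵇ-refl (suc x) = ≡ᵇ-refl x

strictlyIncreasing⁺ : ∀ {vs} → AllPairs _<_ vs → T (strictlyIncreasing vs)
strictlyIncreasing⁺ [] = _
strictlyIncreasing⁺ ([] ∷ []) = _
strictlyIncreasing⁺ ((x<y ∷ _) ∷ pairs) = T-∧⁺ (<⇒<ᵇ x<y) (strictlyIncreasing⁺ pairs)

strictlyIncreasing⁻ : ∀ vs → T (strictlyIncreasing vs) → AllPairs _<_ vs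
strictlyIncreasing⁻ [] _ = []
strictlyIncreasing⁻ (x ∷ []) _ = [] ∷ []
strictlyIncreasing⁻ (x ∷ y ∷ vs) increasing =
  let x<ᵇy , increasing′ = T-∧⁻ (x <ᵇ y) increasing
  in <-chain (<ᵇ⇒< x y x<ᵇy) (strictlyIncreasing⁻ (y ∷ vs) increasing′)
  where
  <-chain : ∀ {x y vs} → x < y → AllPairs _<_ (y ∷ vs) → AllPairs _<_ (x ∷ y ∷ vs)
  <-chain x<y pairs@(y<vs ∷ _) = (x<y ∷ All.map (<-trans x<y) y<vs) ∷ pairs

∈-concatMap⁺′ : ∀ (f : A → List B) {x xs y} → x ∈ xs → y ∈ f x → y ∈ concatMap f xs
∈-concatMap⁺′ f x∈xs y∈fx = ∈-concatMap⁺ f (lose x∈xs y∈fx)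

∈-concatMap⁻′ : ∀ (f : A → List B) xs {y} → y ∈ concatMap f xs → ∃[ x ] (x ∈ xs × y ∈ f x)
∈-concatMap⁻′ f xs = find ∘ ∈-concatMap⁻ f {xs}

concatMap-unique : ∀ (g : A → List B) {xs} → Unique xs → (∀ x → Unique (g x)) →
  (∀ {x y z} → z ∈ g x → z ∈ g y → x ≡ y) → Unique (concatMap g xs)
concatMap-unique g {xs} u ug disjoint =
  Unique.concat⁺ (All.map⁺ (All.tabulate (λ {x} _ → ug x)))
    (AllPairs.map⁺ {f = g} (AllPairs.map (λ x≢y {_} (z∈gx , z∈gy) → x≢y (disjoint z∈gx z∈gy)) u))

AllPairs-⊆ : ∀ {R : A → A → Set} → xs ⊆ ys → AllPairs R ys → AllPairs R xs
AllPairs-⊆ [] [] = []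
AllPairs-⊆ (_ ∷ʳ xs⊆ys) (_ ∷ pairs) = AllPairs-⊆ xs⊆ys pairs
AllPairs-⊆ (refl ∷ xs⊆ys) (rel ∷ pairs) = Sublist.All-resp-⊆ xs⊆ys rel ∷ AllPairs-⊆ xs⊆ys pairs

⊆-map⁻ : ∀ (f : A → B) xs {ys} → ys ⊆ map f xs → ∃[ zs ] (ys ≡ map f zs × zs ⊆ xs)
⊆-map⁻ f [] [] = [] , refl , []
⊆-map⁻ f (x ∷ xs) (_ ∷ʳ ys⊆) with ⊆-map⁻ f xs ys⊆
... | zs , refl , zs⊆ = zs , refl , x ∷ʳ zs⊆
⊆-map⁻ f (x ∷ xs) (refl ∷ ys⊆) with ⊆-map⁻ f xs ys⊆
... | zs , refl , zs⊆ = x ∷ zs , refl , refl ∷ zs⊆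

∑ : List A → (A → ℤ) → ℤ
∑ xs f = foldr _+ℤ_ (⁺ 0) (map f xs)

∑-++ : ∀ (xs ys : List A) f → ∑ (xs ++ ys) f ≡ ∑ xs f +ℤ ∑ ys f
∑-++ [] ys f = sym (ℤ.+-identityˡ _)
∑-++ (x ∷ xs) ys f = trans (cong (f x +ℤ_) (∑-++ xs ys f)) (sym (ℤ.+-assoc (f x) _ _))

∑-concatMap : ∀ (g : A → List B) xs f → ∑ (concatMap g xs) f ≡ ∑ xs (λ x → ∑ (g x) f)
∑-concatMap g [] f = refl
∑-concatMap g (x ∷ xs) f = trans (∑-++ (g x) _ f) (cong (∑ (g x) f +ℤ_) (∑-concatMap g xs f))

∑-map : ∀ (h : A → B) xs f → ∑ (map h xs) f ≡ ∑ xs (f ∘ h)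
∑-map h [] f = refl
∑-map h (x ∷ xs) f = cong (f (h x) +ℤ_) (∑-map h xs f)

∑-cong : ∀ (xs : List A) {f g} → (∀ {x} → x ∈ xs → f x ≡ g x) → ∑ xs f ≡ ∑ xs g
∑-cong [] eq = refl
∑-cong (x ∷ xs) eq = cong₂ _+ℤ_ (eq (here refl)) (∑-cong xs (eq ∘ there))

∑-zero : ∀ (xs : List A) → ∑ xs (λ _ → ⁺ 0) ≡ ⁺ 0
∑-zero [] = refl
∑-zero (x ∷ xs) = trans (ℤ.+-identityˡ _) (∑-zero xs)

∑-*ˡ : ∀ (xs : List A) c f → ∑ xs (λ x → c *ℤ f x) ≡ c *ℤ ∑ xs f
∑-*ˡ [] c f = sym (ℤ.*-zeroʳ c)
∑-*ˡ (x ∷ xs) c f = trans (cong (c *ℤ f x +ℤ_) (∑-*ˡ xs c f)) (sym (ℤ.*-distribˡ-+ c (f x) _))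

∑-↭ : ∀ {xs ys : List A} f → xs ↭ ys → ∑ xs f ≡ ∑ ys f
∑-↭ f xs↭ys = foldr-commMonoid ℤ+.setoid ℤ+.isCommutativeMonoid (↭⇒↭ₛ (↭.map⁺ f xs↭ys))
  where module ℤ+ = CommutativeMonoid ℤ.+-0-commutativeMonoid

∑-sameUniqueElements : ∀ {xs ys : List A} f → Unique xs → Unique ys →
  (∀ {x} → x ∈ xs → x ∈ ys) → (∀ {x} → x ∈ ys → x ∈ xs) → ∑ xs f ≡ ∑ ys f
∑-sameUniqueElements f u v to from = ∑-↭ f (∼bag⇒↭ (unique∧set⇒bag u v (mk⇔ to from)))

interval : ℕ → ℕ → List ℕ
interval a zero = []
interval a (suc L) = a ∷ interval (suc a) L

∈-interval⁻ : ∀ {v} a L → v ∈ interval a L → a ≤ v × v < a + L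
∈-interval⁻ a (suc L) (here refl) = ≤-refl , m<m+n a z<s
∈-interval⁻ {v} a (suc L) (there v∈) with ∈-interval⁻ (suc a) L v∈
... | a<v , v<a+1+L = <⇒≤ a<v , subst (v <_) (sym (+-suc a L)) v<a+1+L

∈-interval⁺ : ∀ {v} a L → a ≤ v → v < a + L → v ∈ interval a L
∈-interval⁺ a zero a≤v v<a+0 = ⊥-elim (<-irrefl refl (<-≤-trans v<a+0 (≤-trans (≤-reflexive (+-identityʳ a)) a≤v)))
∈-interval⁺ {v} a (suc L) a≤v v<a+1+L with a ≟ v
... | yes refl = here refl
... | no a≢v = there (∈-interval⁺ (suc a) L (≤∧≢⇒< a≤v a≢v) (subst (v <_) (+-suc a L) v<a+1+L))

interval-⊆ : ∀ {a b} L M → b ≤ a → a + L ≤ b + M → interval a L ⊆ interval b M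
interval-⊆ zero M _ _ = Sublist.minimum _
interval-⊆ {a} {b} (suc L) zero b≤a a+1+L≤b+0 =
  ⊥-elim (<-irrefl refl (<-≤-trans (m<m+n a z<s) (≤-trans a+1+L≤b+0 (≤-trans (≤-reflexive (+-identityʳ b)) b≤a))))
interval-⊆ {a} {b} (suc L) (suc M) b≤a a+1+L≤b+1+M with a ≟ b
... | yes refl = refl ∷ interval-⊆ L M ≤-refl (subst₂ _≤_ (+-suc a L) (+-suc a M) a+1+L≤b+1+M)
... | no a≢b = b ∷ʳ interval-⊆ (suc L) M (≤∧≢⇒< b≤a (a≢b ∘ sym)) (subst (a + suc L ≤_) (+-suc b M) a+1+L≤b+1+M)

interval-increasing : ∀ a L → AllPairs _<_ (interval a L)
interval-increasing a zero = []
interval-increasing a (suc L) =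
  All.tabulate (λ v∈ → proj₁ (∈-interval⁻ (suc a) L v∈)) ∷ interval-increasing (suc a) L

interval-unique : ∀ a L → Unique (interval a L)
interval-unique a L = AllPairs.map <⇒≢ (interval-increasing a L)

interval-++ : ∀ a L M → interval a (L + M) ≡ interval a L ++ interval (a + L) M
interval-++ a zero M = cong (λ b → interval b M) (sym (+-identityʳ a))
interval-++ a (suc L) M = cong (a ∷_) (trans (interval-++ (suc a) L M) (cong (λ b → interval (suc a) L ++ interval b M) (sym (+-suc a L))))

interval-snoc : ∀ a L → interval a L ++ (a + L) ∷ [] ≡ interval a (suc L)
interval-snoc a L = trans (sym (interval-++ a L 1)) (cong (interval a) (+-comm L 1))

length-interval : ∀ a L → length (interval a L) ≡ L
length-interval a zero = refl
length-interval a (suc L) = cong suc (length-interval (suc a) L)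

applyUpTo≡interval : ∀ (f : ℕ → ℕ) a L → (∀ v → f v ≡ a + v) → applyUpTo f L ≡ interval a L
applyUpTo≡interval f a zero f≡ = refl
applyUpTo≡interval f a (suc L) f≡ =
  cong₂ _∷_ (trans (f≡ 0) (+-identityʳ a)) (applyUpTo≡interval (f ∘ suc) (suc a) L (λ v → trans (f≡ (suc v)) (+-suc a v)))

range≡interval : ∀ lo hi → range lo hi ≡ interval lo (suc hi ∸ lo)
range≡interval lo hi = trans (map-upTo (lo +_) (suc hi ∸ lo)) (applyUpTo≡interval (lo +_) lo _ (λ _ → refl))

∈-range⁺ : ∀ {v} lo hi → lo ≤ v → v ≤ hi → v ∈ range lo hi
∈-range⁺ {v} lo hi lo≤v v≤hi = subst (v ∈_) (sym (range≡interval lo hi))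
  (∈-interval⁺ lo _ lo≤v (subst (v <_) (sym (m+[n∸m]≡n (≤-trans lo≤v (m≤n⇒m≤1+n v≤hi)))) (s≤s v≤hi)))

∈-range⁻ : ∀ {v} lo hi → v ∈ range lo hi → lo ≤ v × v ≤ hi
∈-range⁻ {v} lo hi v∈ with ∈-interval⁻ lo _ (subst (v ∈_) (range≡interval lo hi) v∈) | lo ≤? suc hi
... | lo≤v , v<end | yes lo≤1+hi = lo≤v , ≤-pred (subst (v <_) (m+[n∸m]≡n lo≤1+hi) v<end)
... | lo≤v , v<end | no lo≰1+hi =
  ⊥-elim (<-irrefl refl (<-≤-trans v<end
    (subst (_≤ v) (sym (trans (cong (lo +_) (m≤n⇒m∸n≡0 (<⇒≤ (≰⇒> lo≰1+hi)))) (+-identityʳ lo))) lo≤v)))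

range-unique : ∀ lo hi → Unique (range lo hi)
range-unique lo hi = subst Unique (sym (range≡interval lo hi)) (interval-unique lo _)

∈-sublists⁺ : ys ⊆ xs → ys ∈ sublists xs
∈-sublists⁺ [] = here refl
∈-sublists⁺ {xs = x ∷ xs} (refl ∷ ys⊆xs) = ∈-++⁺ˡ (∈-map⁺ (x ∷_) (∈-sublists⁺ ys⊆xs))
∈-sublists⁺ {xs = x ∷ xs} (.x ∷ʳ ys⊆xs) = ∈-++⁺ʳ (map (x ∷_) (sublists xs)) (∈-sublists⁺ ys⊆xs)

∈-sublists⁻ : ∀ (xs : List A) → ys ∈ sublists xs → ys ⊆ xs
∈-sublists⁻ [] (here refl) = []
∈-sublists⁻ (x ∷ xs) ys∈ with ∈-++⁻ (map (x ∷_) (sublists xs)) ys∈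
... | inj₂ ys∈′ = x ∷ʳ ∈-sublists⁻ xs ys∈′
... | inj₁ ys∈′ with ∈-map⁻ (x ∷_) ys∈′
...   | zs , zs∈ , refl = refl ∷ ∈-sublists⁻ xs zs∈

sublists-unique : Unique xs → Unique (sublists xs)
sublists-unique [] = [] ∷ []
sublists-unique {xs = x ∷ xs} (x∉xs ∷ u) =
  Unique.++⁺ (Unique.map⁺ ∷-injectiveʳ (sublists-unique u)) (sublists-unique u) disjoint
  where
  disjoint : ∀ {zs} → ¬ (zs ∈ map (x ∷_) (sublists xs) × zs ∈ sublists xs)
  disjoint (zs∈ , zs∈′) with ∈-map⁻ (x ∷_) zs∈
  ... | _ , _ , refl = All.lookup x∉xs (Sublist.lookup (∈-sublists⁻ xs zs∈′) (here refl)) refl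

∈-listsOf⁺ : All (_∈ xs) ys → ys ∈ listsOf xs (length ys)
∈-listsOf⁺ [] = here refl
∈-listsOf⁺ {xs = xs} {ys = y ∷ ys} (y∈xs ∷ ys⊆xs) =
  ∈-concatMap⁺′ (λ x → map (x ∷_) (listsOf xs (length ys))) y∈xs (∈-map⁺ (y ∷_) (∈-listsOf⁺ ys⊆xs))

∈-listsOf⁻ : ∀ k → ys ∈ listsOf xs k → length ys ≡ k × All (_∈ xs) ys
∈-listsOf⁻ zero (here refl) = refl , []
∈-listsOf⁻ {xs = xs} (suc k) ys∈ with ∈-concatMap⁻′ (λ x → map (x ∷_) (listsOf xs k)) xs ys∈
... | x , x∈xs , ys∈′ with ∈-map⁻ (x ∷_) ys∈′
...   | zs , zs∈ , refl with ∈-listsOf⁻ k zs∈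
...     | refl , zs⊆xs = refl , x∈xs ∷ zs⊆xs

listsOf-unique : ∀ k → Unique xs → Unique (listsOf xs k)
listsOf-unique zero u = [] ∷ []
listsOf-unique {xs = xs} (suc k) u = concatMap-unique _ u (λ x → Unique.map⁺ ∷-injectiveʳ (listsOf-unique k u)) sameHead
  where
  sameHead : ∀ {x y zs} → zs ∈ map (x ∷_) (listsOf xs k) → zs ∈ map (y ∷_) (listsOf xs k) → x ≡ y
  sameHead zs∈ zs∈′ with ∈-map⁻ _ zs∈ | ∈-map⁻ _ zs∈′
  ... | _ , _ , refl | _ , _ , refl = refl

length≤sum : ∀ {α} → All (1 ≤_) α → length α ≤ sum α
length≤sum [] = z≤n
length≤sum (1≤a ∷ pos) = +-mono-≤ 1≤a (length≤sum pos)

∈⇒≤sum : ∀ {a α} → a ∈ α → a ≤ sum α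
∈⇒≤sum {α = b ∷ α} (here refl) = m≤m+n b (sum α)
∈⇒≤sum {α = b ∷ α} (there a∈α) = ≤-trans (∈⇒≤sum a∈α) (m≤n+m (sum α) b)

∈-compositions⁺ : ∀ {α} → All (1 ≤_) α → α ∈ compositions (sum α)
∈-compositions⁺ {α} pos = ∈-filterB⁺ _
  (∈-concatMap⁺′ (listsOf (range 1 (sum α))) (∈-range⁺ 0 _ z≤n (length≤sum pos))
    (∈-listsOf⁺ (All.tabulate (λ {a} a∈α → ∈-range⁺ 1 _ (All.lookup pos a∈α) (∈⇒≤sum a∈α)))))
  (≡⇒≡ᵇ (sum α) (sum α) refl)

∈-compositions⁻ : ∀ {α} m → α ∈ compositions m → All (1 ≤_) α × sum α ≡ m
∈-compositions⁻ {α} m α∈ with ∈-filterB⁻ _ _ α∈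
... | α∈′ , sum≡ with ∈-concatMap⁻′ (listsOf (range 1 m)) (range 0 m) α∈′
...   | k , _ , α∈″ = All.map (proj₁ ∘ ∈-range⁻ 1 m) (proj₂ (∈-listsOf⁻ k α∈″)) , ≡ᵇ⇒≡ (sum α) m sum≡

compositions-unique : ∀ m → Unique (compositions m)
compositions-unique m = filterB-unique _
  (concatMap-unique (listsOf (range 1 m)) (range-unique 0 m) (λ k → listsOf-unique k (range-unique 1 m))
    (λ {k} {k′} α∈ α∈′ → trans (sym (proj₁ (∈-listsOf⁻ k α∈))) (proj₁ (∈-listsOf⁻ k′ α∈′))))

coeff : Poly → ℕ → ℤ
coeff p k = coeffAt k p

-- shift w (coeff p) = coeff (q^w · p)
shift : ℕ → (ℕ → ℤ) → ℕ → ℤ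
shift zero f k = f k
shift (suc w) f zero = ⁺ 0
shift (suc w) f (suc k) = shift w f k

shift-cong : ∀ w {f g : ℕ → ℤ} → (∀ k → f k ≡ g k) → ∀ k → shift w f k ≡ shift w g k
shift-cong zero f≗g k = f≗g k
shift-cong (suc w) f≗g zero = refl
shift-cong (suc w) f≗g (suc k) = shift-cong w f≗g k

shift-+ : ∀ w (f g : ℕ → ℤ) k → shift w (λ k → f k +ℤ g k) k ≡ shift w f k +ℤ shift w g k
shift-+ zero f g k = refl
shift-+ (suc w) f g zero = refl
shift-+ (suc w) f g (suc k) = shift-+ w f g k

shift-*ˡ : ∀ w c (f : ℕ → ℤ) k → shift w (λ k → c *ℤ f k) k ≡ c *ℤ shift w f k
shift-*ˡ zero c f k = refl
shift-*ˡ (suc w) c f zero = sym (ℤ.*-zeroʳ c)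
shift-*ˡ (suc w) c f (suc k) = shift-*ˡ w c f k

shift-neg : ∀ w (f : ℕ → ℤ) k → shift w (λ k → - f k) k ≡ - shift w f k
shift-neg w f k = trans (shift-cong w (λ k → sym (ℤ.-1*i≡-i (f k))) k) (trans (shift-*ˡ w (- ⁺ 1) f k) (ℤ.-1*i≡-i (shift w f k)))

shift-− : ∀ w (f g : ℕ → ℤ) k → shift w f k +ℤ - shift w g k ≡ shift w (λ k → f k +ℤ - g k) k
shift-− w f g k = trans (cong (shift w f k +ℤ_) (sym (shift-neg w g k))) (sym (shift-+ w f _ k))

shift-zero : ∀ w k → shift w (λ _ → ⁺ 0) k ≡ ⁺ 0
shift-zero zero k = refl
shift-zero (suc w) zero = refl
shift-zero (suc w) (suc k) = shift-zero w k

shift-suc : ∀ w (f : ℕ → ℤ) k → shift w (shift 1 f) k ≡ shift (suc w) f k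
shift-suc zero f k = refl
shift-suc (suc w) f zero = refl
shift-suc (suc w) f (suc k) = shift-suc w f k

∑-shift : ∀ (xs : List A) w (g : A → ℕ → ℤ) k → ∑ xs (λ x → shift w (g x) k) ≡ shift w (λ k → ∑ xs (λ x → g x k)) k
∑-shift [] w g k = sym (shift-zero w k)
∑-shift (x ∷ xs) w g k = trans (cong (shift w (g x) k +ℤ_) (∑-shift xs w g k)) (sym (shift-+ w (g x) _ k))

coeff-polyAdd : ∀ p q k → coeff (polyAdd p q) k ≡ coeff p k +ℤ coeff q k
coeff-polyAdd [] q k = sym (ℤ.+-identityˡ _)
coeff-polyAdd (a ∷ p) [] k = sym (ℤ.+-identityʳ _)
coeff-polyAdd (a ∷ p) (b ∷ q) zero = refl
coeff-polyAdd (a ∷ p) (b ∷ q) (suc k) = coeff-polyAdd p q k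

coeff-scale : ∀ a q k → coeff (map (a *ℤ_) q) k ≡ a *ℤ coeff q k
coeff-scale a [] k = sym (ℤ.*-zeroʳ a)
coeff-scale a (b ∷ q) zero = refl
coeff-scale a (b ∷ q) (suc k) = coeff-scale a q k

coeff-0∷ : ∀ p k → coeff (⁺ 0 ∷ p) k ≡ shift 1 (coeff p) k
coeff-0∷ p zero = refl
coeff-0∷ p (suc k) = refl

coeff-polyMul-∷ : ∀ a p q k → coeff (polyMul (a ∷ p) q) k ≡ a *ℤ coeff q k +ℤ shift 1 (coeff (polyMul p q)) k
coeff-polyMul-∷ a p q k =
  trans (coeff-polyAdd (map (a *ℤ_) q) _ k) (cong₂ _+ℤ_ (coeff-scale a q k) (coeff-0∷ (polyMul p q) k))

coeff-polyMul-polyAdd : ∀ p p′ q k → coeff (polyMul (polyAdd p p′) q) k ≡ coeff (polyMul p q) k +ℤ coeff (polyMul p′ q) k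
coeff-polyMul-polyAdd [] p′ q k = sym (ℤ.+-identityˡ _)
coeff-polyMul-polyAdd (a ∷ p) [] q k = sym (ℤ.+-identityʳ _)
coeff-polyMul-polyAdd (a ∷ p) (b ∷ p′) q k = begin
  coeff (polyMul ((a +ℤ b) ∷ polyAdd p p′) q) k
    ≡⟨ coeff-polyMul-∷ (a +ℤ b) (polyAdd p p′) q k ⟩
  (a +ℤ b) *ℤ coeff q k +ℤ shift 1 (coeff (polyMul (polyAdd p p′) q)) k
    ≡⟨ cong ((a +ℤ b) *ℤ coeff q k +ℤ_) (trans (shift-cong 1 (coeff-polyMul-polyAdd p p′ q) k) (shift-+ 1 _ _ k)) ⟩
  (a +ℤ b) *ℤ coeff q k +ℤ (shift 1 (coeff (polyMul p q)) k +ℤ shift 1 (coeff (polyMul p′ q)) k)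
    ≡⟨ interchange a b _ _ _ ⟩
  (a *ℤ coeff q k +ℤ shift 1 (coeff (polyMul p q)) k) +ℤ (b *ℤ coeff q k +ℤ shift 1 (coeff (polyMul p′ q)) k)
    ≡⟨ sym (cong₂ _+ℤ_ (coeff-polyMul-∷ a p q k) (coeff-polyMul-∷ b p′ q k)) ⟩
  coeff (polyMul (a ∷ p) q) k +ℤ coeff (polyMul (b ∷ p′) q) k ∎
  where
  open ≡-Reasoning
  interchange : ∀ (a b x y z : ℤ) → (a +ℤ b) *ℤ x +ℤ (y +ℤ z) ≡ (a *ℤ x +ℤ y) +ℤ (b *ℤ x +ℤ z)
  interchange = solve-∀

coeff-qintMinus1-polyMul : ∀ y p k → coeff (polyMul (qintMinus1 y) p) k ≡ coeff (polyMul (qint y) p) k +ℤ - coeff p k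
coeff-qintMinus1-polyMul y p k = begin
  coeff (polyMul (qintMinus1 y) p) k
    ≡⟨ coeff-polyMul-polyAdd (qint y) (- ⁺ 1 ∷ []) p k ⟩
  coeff (polyMul (qint y) p) k +ℤ coeff (polyMul (- ⁺ 1 ∷ []) p) k
    ≡⟨ cong (coeff (polyMul (qint y) p) k +ℤ_)
         (trans (coeff-polyMul-∷ (- ⁺ 1) [] p k) (cong₂ _+ℤ_ (ℤ.-1*i≡-i (coeff p k)) (shift-zero 1 k))) ⟩
  coeff (polyMul (qint y) p) k +ℤ (- coeff p k +ℤ ⁺ 0)
    ≡⟨ cong (coeff (polyMul (qint y) p) k +ℤ_) (ℤ.+-identityʳ _) ⟩
  coeff (polyMul (qint y) p) k +ℤ - coeff p k ∎
  where open ≡-Reasoning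

∑-shift≡qint : ∀ y s p k → ∑ (interval (suc s) y) (λ r → shift (r ∸ 1) (coeff p) k) ≡ shift s (coeff (polyMul (qint y) p)) k
∑-shift≡qint zero s p k = sym (shift-zero s k)
∑-shift≡qint (suc y) s p k = begin
  shift s (coeff p) k +ℤ ∑ (interval (suc (suc s)) y) (λ r → shift (r ∸ 1) (coeff p) k)
    ≡⟨ cong (shift s (coeff p) k +ℤ_) (trans (∑-shift≡qint y (suc s) p k) (sym (shift-suc s _ k))) ⟩
  shift s (coeff p) k +ℤ shift s (shift 1 (coeff (polyMul (qint y) p))) k
    ≡⟨ sym (shift-+ s (coeff p) _ k) ⟩
  shift s (λ k → coeff p k +ℤ shift 1 (coeff (polyMul (qint y) p)) k) k
    ≡⟨ shift-cong s (λ k → sym (trans (coeff-polyMul-∷ (⁺ 1) (qint y) p k)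
         (cong (_+ℤ shift 1 (coeff (polyMul (qint y) p)) k) (ℤ.*-identityˡ (coeff p k))))) k ⟩
  shift s (coeff (polyMul (qint (suc y)) p)) k ∎
  where open ≡-Reasoning

coeff-monomial-*ˡ : ∀ c d w k → coeff (monomial (c *ℤ d) w) k ≡ c *ℤ coeff (monomial d w) k
coeff-monomial-*ˡ c d zero zero = refl
coeff-monomial-*ˡ c d zero (suc k) = sym (ℤ.*-zeroʳ c)
coeff-monomial-*ˡ c d (suc w) zero = sym (ℤ.*-zeroʳ c)
coeff-monomial-*ˡ c d (suc w) (suc k) = coeff-monomial-*ˡ c d w k

coeff-monomial-+ : ∀ c d w w′ k → coeff (monomial (c *ℤ d) (w + w′)) k ≡ c *ℤ shift w (coeff (monomial d w′)) k
coeff-monomial-+ c d zero w′ k = coeff-monomial-*ˡ c d w′ k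
coeff-monomial-+ c d (suc w) w′ zero = sym (ℤ.*-zeroʳ c)
coeff-monomial-+ c d (suc w) w′ (suc k) = coeff-monomial-+ c d w w′ k

negOnePow-+ : ∀ m n → negOnePow (m + n) ≡ negOnePow m *ℤ negOnePow n
negOnePow-+ zero n = sym (ℤ.*-identityˡ _)
negOnePow-+ (suc m) n = trans (cong -_ (negOnePow-+ m n)) (ℤ.neg-distribˡ-* (negOnePow m) (negOnePow n))

sum≥1 : ∀ α {r} → 1 ≤ r → r ≤ headD 0 α → 1 ≤ sum α
sum≥1 [] {suc r} _ ()
sum≥1 (y ∷ α) 1≤r r≤y = ≤-trans (≤-trans 1≤r r≤y) (m≤m+n y (sum α))

succEdges : List ℕ → List (ℕ × ℕ)
succEdges = map (λ x → x , suc x)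

intervalTriple : ℕ → List ℕ → ℕ → TreeTriple
intervalTriple a α r = treeTriple (interval a (sum α)) (succEdges (interval a (sum α ∸ 1))) α r

edgeIn-succEdges⁻ : ∀ X {u v} → T (edgeIn (succEdges X) u v) →
  ∃[ x ] (x ∈ X × (u ≡ x × v ≡ suc x ⊎ v ≡ x × u ≡ suc x))
edgeIn-succEdges⁻ X {u} {v} uv∈ with find (anyB⁻ _ (succEdges X) uv∈)
... | e , e∈ , match with ∈-map⁻ _ e∈
...   | x , x∈X , refl with Equivalence.to (T-∨ {(x ≡ᵇ u) ∧ (suc x ≡ᵇ v)}) match
...     | inj₁ fwd = let x≡ᵇu , 1+x≡ᵇv = T-∧⁻ (x ≡ᵇ u) fwd
                     in x , x∈X , inj₁ (sym (≡ᵇ⇒≡ x u x≡ᵇu) , sym (≡ᵇ⇒≡ (suc x) v 1+x≡ᵇv))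
...     | inj₂ bwd = let x≡ᵇv , 1+x≡ᵇu = T-∧⁻ (x ≡ᵇ v) bwd
                     in x , x∈X , inj₂ (sym (≡ᵇ⇒≡ x v x≡ᵇv) , sym (≡ᵇ⇒≡ (suc x) u 1+x≡ᵇu))

edgeIn-succEdges⁺ : ∀ X {x} → x ∈ X → T (edgeIn (succEdges X) (suc x) x)
edgeIn-succEdges⁺ X {x} x∈X = anyB⁺ _ (lose (∈-map⁺ (λ x → x , suc x) x∈X)
  (Equivalence.from (T-∨ {(x ≡ᵇ suc x) ∧ (suc x ≡ᵇ x)}) (inj₂ (T-∧⁺ (≡⇒≡ᵇ x x refl) (≡⇒≡ᵇ (suc x) (suc x) refl)))))

isNBC-succEdges : ∀ V X α r → Unique V → T (isNBC (treeTriple V (succEdges X) α r))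
isNBC-succEdges V X α r u = allB⁻ _ {xs = V} (All.tabulate (λ {v} _ →
  ≤⇒≤ᵇ (countB-unique u _ (All.tabulate (λ u∈ → onlySucc v (proj₂ (∈-filterB⁻ _ V u∈)))))))
  where
  onlySucc : ∀ v {w} → T ((v <ᵇ w) ∧ edgeIn (succEdges X) v w) → w ≡ suc v
  onlySucc v {w} larger-neighbour with T-∧⁻ (v <ᵇ w) larger-neighbour
  ... | v<w , vw∈ with edgeIn-succEdges⁻ X vw∈
  ...   | x , _ , inj₁ (refl , refl) = refl
  ...   | x , _ , inj₂ (refl , refl) = ⊥-elim (<-asym (<ᵇ⇒< _ _ v<w) (n<1+n x))

isFrontier : List (ℕ × ℕ) → List ℕ → ℕ → Bool
isFrontier Ed read v = not (elemB v read) ∧ anyB (edgeIn Ed v) read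

listGo-step : ∀ V Ed f read {c cs} → filterB (isFrontier Ed read) V ≡ c ∷ cs →
  listGo V Ed (suc f) read ≡ listGo V Ed f (read ++ minL (c ∷ cs) ∷ [])
listGo-step V Ed f read eq rewrite eq = refl

listGo-stop : ∀ V Ed f read → filterB (isFrontier Ed read) V ≡ [] → listGo V Ed f read ≡ read
listGo-stop V Ed zero read eq = refl
listGo-stop V Ed (suc f) read eq rewrite eq = refl

frontier-none : ∀ Ed a c → filterB (isFrontier Ed (interval a c)) (interval a c) ≡ []
frontier-none Ed a c = filterB-none _ (All.tabulate (λ {v} v∈ frontier →
  ∈⇒¬T-not-elemB (interval a c) v∈ (proj₁ (T-∧⁻ (not (elemB v (interval a c))) frontier))))

frontier-next : ∀ X a c m → a + c ∈ X →
  filterB (isFrontier (succEdges X) (interval a (suc c))) (interval a (suc c + suc m)) ≡ (a + suc c) ∷ []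
frontier-next X a c m a+c∈X = begin
  filterB P (interval a (suc c + suc m))
    ≡⟨ cong (filterB P) (interval-++ a (suc c) (suc m)) ⟩
  filterB P (interval a (suc c) ++ interval (a + suc c) (suc m))
    ≡⟨ filterB-++ P (interval a (suc c)) _ ⟩
  filterB P (interval a (suc c)) ++ filterB P (interval (a + suc c) (suc m))
    ≡⟨ cong (_++ filterB P (interval (a + suc c) (suc m))) (frontier-none (succEdges X) a (suc c)) ⟩
  filterB P ((a + suc c) ∷ interval (suc (a + suc c)) m)
    ≡⟨ filterB-accept P {xs = interval (suc (a + suc c)) m} next-is-frontier ⟩
  (a + suc c) ∷ filterB P (interval (suc (a + suc c)) m)
    ≡⟨ cong ((a + suc c) ∷_) (filterB-none P (All.tabulate beyond-is-not)) ⟩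
  (a + suc c) ∷ [] ∎
  where
  open ≡-Reasoning
  P = isFrontier (succEdges X) (interval a (suc c))
  next-is-frontier : T (P (a + suc c))
  next-is-frontier = T-∧⁺
    (∉⇒T-not-elemB _ (λ a+1+c∈ → <-irrefl refl (proj₂ (∈-interval⁻ a (suc c) a+1+c∈))))
    (anyB⁺ _ (lose (∈-interval⁺ a (suc c) (m≤m+n a c) (+-monoʳ-< a ≤-refl))
      (subst (λ w → T (edgeIn (succEdges X) w (a + c))) (sym (+-suc a c)) (edgeIn-succEdges⁺ X a+c∈X))))
  beyond-is-not : ∀ {v} → v ∈ interval (suc (a + suc c)) m → ¬ T (P v)
  beyond-is-not {v} v∈ frontier with find (anyB⁻ _ _ (proj₂ (T-∧⁻ (not (elemB v (interval a (suc c)))) frontier)))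
  ... | u , u∈ , vu∈ with edgeIn-succEdges⁻ X vu∈ | proj₁ (∈-interval⁻ _ m v∈) | proj₂ (∈-interval⁻ a (suc c) u∈)
  ...   | x , _ , inj₁ (refl , refl) | far | u<end = <-irrefl refl (<-trans (<-trans (n<1+n x) u<end) far)
  ...   | x , _ , inj₂ (refl , refl) | far | u<end = <-irrefl refl (≤-trans far u<end)

listGo-interval : ∀ X a c m f → m ≤ f → (∀ {x} → a ≤ x → suc x < a + (suc c + m) → x ∈ X) →
  listGo (interval a (suc c + m)) (succEdges X) f (interval a (suc c)) ≡ interval a (suc c + m)
listGo-interval X a c zero f _ _ rewrite +-identityʳ c = listGo-stop _ _ f _ (frontier-none (succEdges X) a (suc c))
listGo-interval X a c (suc m) (suc f) (s≤s m≤f) edges = begin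
  listGo V (succEdges X) (suc f) (interval a (suc c))
    ≡⟨ listGo-step V (succEdges X) f (interval a (suc c)) (frontier-next X a c m a+c∈X) ⟩
  listGo V (succEdges X) f (interval a (suc c) ++ (a + suc c) ∷ [])
    ≡⟨ cong (listGo V (succEdges X) f) (interval-snoc a (suc c)) ⟩
  listGo V (succEdges X) f (interval a (suc (suc c)))
    ≡⟨ cong (λ L → listGo (interval a L) (succEdges X) f (interval a (suc (suc c)))) (+-suc (suc c) m) ⟩
  listGo (interval a (suc (suc c) + m)) (succEdges X) f (interval a (suc (suc c)))
    ≡⟨ listGo-interval X a (suc c) m f m≤f
         (λ {x} a≤x x+1<end → edges a≤x (subst (λ L → suc x < a + L) (sym (+-suc (suc c) m)) x+1<end)) ⟩
  interval a (suc (suc c) + m)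
    ≡⟨ cong (interval a) (sym (+-suc (suc c) m)) ⟩
  V ∎
  where
  open ≡-Reasoning
  V = interval a (suc c + suc m)
  a+c∈X : a + c ∈ X
  a+c∈X = edges (m≤m+n a c) (subst (_< a + (suc c + suc m)) (+-suc a c) (+-monoʳ-< a (s≤s (m<m+n c z<s))))

minL-interval : ∀ a L → minL (interval a (suc L)) ≡ a
minL-interval a L = foldr-⊓ (All.tabulate (λ v∈ → <⇒≤ (proj₁ (∈-interval⁻ (suc a) L v∈))))
  where
  foldr-⊓ : ∀ {vs} → All (a ≤_) vs → foldr _⊓_ a vs ≡ a
  foldr-⊓ [] = refl
  foldr-⊓ (a≤v ∷ a≤vs) rewrite foldr-⊓ a≤vs = m≥n⇒m⊓n≡n a≤v

listT-interval : ∀ a s α r → 1 ≤ s → listT (treeTriple (interval a s) (succEdges (interval a (s ∸ 1))) α r) ≡ interval a s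
listT-interval a (suc L) α r _ rewrite length-interval (suc a) L | minL-interval a L =
  listGo-interval (interval a L) a 0 L (suc L) (n≤1+n L)
    (λ {x} a≤x x+1<end → ∈-interval⁺ a L a≤x (≤-pred (subst (suc (suc x) ≤_) (+-suc a L) x+1<end)))

listT-intervalTriple : ∀ a α r → 1 ≤ sum α → listT (intervalTriple a α r) ≡ interval a (sum α)
listT-intervalTriple a α r = listT-interval a (sum α) α r

UnitSteps : List ℕ → List ℕ → Set
UnitSteps V X = All (λ x → x ∈ V × suc x ∈ V) X

∈-tail : ∀ {v w W} → w ∈ v ∷ W → v < w → w ∈ W
∈-tail (here refl) v<v = ⊥-elim (<-irrefl refl v<v)
∈-tail (there w∈W) _ = w∈W

unitSteps-tail : ∀ {v W X} → All (v <_) X → UnitSteps (v ∷ W) X → UnitSteps W X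
unitSteps-tail v<X steps = All.map (λ (v<x , x∈ , x+1∈) → ∈-tail x∈ v<x , ∈-tail x+1∈ (m<n⇒m<1+n v<x)) (All.zip (v<X , steps))

unitSteps-length≤ : ∀ v V X → AllPairs _<_ (v ∷ V) → AllPairs _<_ X → UnitSteps (v ∷ V) X → length X ≤ length V
unitSteps-length≤ v [] [] _ _ _ = z≤n
unitSteps-length≤ v [] (x ∷ X) _ _ ((here refl , here x+1≡x) ∷ _) = ⊥-elim (1+n≢n x+1≡x)
unitSteps-length≤ v (w ∷ V) [] _ _ _ = z≤n
unitSteps-length≤ v (w ∷ V) (x ∷ X) (v<wV ∷ incV) (x<X ∷ incX) ((x∈ , x+1∈) ∷ steps) with x∈
... | here refl = s≤s (unitSteps-length≤ w V X incV incX (unitSteps-tail x<X steps))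
... | there x∈wV = m≤n⇒m≤1+n (unitSteps-length≤ w V (x ∷ X) incV (x<X ∷ incX)
  (unitSteps-tail (v<x ∷ All.map (<-trans v<x) x<X) ((x∈ , x+1∈) ∷ steps)))
  where
  v<x = All.lookup v<wV x∈wV

-- No connectivity is needed: |V| - 1 unit steps inside an increasing list V force it to be an interval.
unitSteps-interval : ∀ v V X → AllPairs _<_ (v ∷ V) → AllPairs _<_ X → UnitSteps (v ∷ V) X → length X ≡ length V →
  v ∷ V ≡ interval v (suc (length V)) × X ≡ interval v (length V)
unitSteps-interval v [] [] _ _ _ _ = refl , refl
unitSteps-interval v (w ∷ V) (x ∷ X) (v<wV ∷ incV) (x<X ∷ incX) ((x∈ , x+1∈) ∷ steps) len≡ with x∈
... | there x∈wV = ⊥-elim (<-irrefl refl (subst (λ l → suc l ≤ length V) (suc-injective len≡)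
  (unitSteps-length≤ w V (x ∷ X) incV (x<X ∷ incX) (unitSteps-tail (v<x ∷ All.map (<-trans v<x) x<X) ((x∈ , x+1∈) ∷ steps)))))
  where
  v<x = All.lookup v<wV x∈wV
... | here refl with w≡1+v | unitSteps-interval w V X incV incX (unitSteps-tail x<X steps) (suc-injective len≡)
  where
  w≡1+v : w ≡ suc v
  w≡1+v with ∈-tail x+1∈ (n<1+n v)
  ... | here v+1≡w = sym v+1≡w
  ... | there v+1∈V = ⊥-elim (<-irrefl refl (<-≤-trans (All.lookup v<wV (here refl)) (≤-pred (All.lookup (AllPairs.head incV) v+1∈V))))
... | refl | wV≡ , X≡ = cong (v ∷_) wV≡ , cong (v ∷_) X≡

edgesOf-unique : ∀ G N → Unique (edgesOf G N)
edgesOf-unique G N = concatMap-unique _ (range-unique 1 N)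
  (λ a → Unique.map⁺ (cong proj₂) (filterB-unique (G a) (range-unique (suc a) N)))
  (λ e∈ e∈′ → trans (sym (source e∈)) (source e∈′))
  where
  source : ∀ {a e bs} → e ∈ map (a ,_) bs → proj₁ e ≡ a
  source e∈ with ∈-map⁻ _ e∈
  ... | _ , _ , refl = refl

treeTriples-unique : ∀ G N → Unique (treeTriples G N)
treeTriples-unique G N = filterB-unique _ (concatMap-unique _ (sublists-unique (range-unique 1 N)) withVerts-unique
  (λ t∈ t∈′ → trans (sym (verts-withVerts t∈)) (verts-withVerts t∈′)))
  where
  withComp : List ℕ → List (ℕ × ℕ) → List ℕ → List TreeTriple
  withComp V Ed α = map (treeTriple V Ed α) (range 1 (headD 0 α))
  withEdges : List ℕ → List (ℕ × ℕ) → List TreeTriple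
  withEdges V Ed = concatMap (withComp V Ed) (compositions (length V))
  withVerts : List ℕ → List TreeTriple
  withVerts V = concatMap (withEdges V) (sublists (edgesOf G N))

  comp-withComp : ∀ {V Ed α t} → t ∈ withComp V Ed α → comp t ≡ α
  comp-withComp t∈ with ∈-map⁻ _ t∈
  ... | _ , _ , refl = refl
  shape-withEdges : ∀ {V Ed t} → t ∈ withEdges V Ed → verts t ≡ V × edges t ≡ Ed
  shape-withEdges {V} t∈ with ∈-concatMap⁻′ _ (compositions (length V)) t∈
  ... | _ , _ , t∈′ with ∈-map⁻ _ t∈′
  ...   | _ , _ , refl = refl , refl
  verts-withVerts : ∀ {V t} → t ∈ withVerts V → verts t ≡ V
  verts-withVerts {V} t∈ with ∈-concatMap⁻′ _ (sublists (edgesOf G N)) t∈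
  ... | Ed , _ , t∈′ = proj₁ (shape-withEdges {V} {Ed} t∈′)

  withEdges-unique : ∀ V Ed → Unique (withEdges V Ed)
  withEdges-unique V Ed = concatMap-unique _ (compositions-unique (length V))
    (λ α → Unique.map⁺ (cong rr) (range-unique 1 (headD 0 α)))
    (λ t∈ t∈′ → trans (sym (comp-withComp t∈)) (comp-withComp t∈′))
  withVerts-unique : ∀ V → Unique (withVerts V)
  withVerts-unique V = concatMap-unique _ (sublists-unique (edgesOf-unique G N)) (withEdges-unique V)
    (λ {Ed} {Ed′} t∈ t∈′ → trans (sym (proj₂ (shape-withEdges {V} {Ed} t∈))) (proj₂ (shape-withEdges {V} {Ed′} t∈′)))

forestTriples-unique : ∀ G N → Unique (forestTriples G N)
forestTriples-unique G N = filterB-unique _ (concatMap-unique _ (range-unique 0 N)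
  (λ k → listsOf-unique k (treeTriples-unique G N))
  (λ {k} {k′} ts∈ ts∈′ → trans (sym (proj₁ (∈-listsOf⁻ k ts∈))) (proj₁ (∈-listsOf⁻ k′ ts∈′))))

FT-unique : ∀ G n i j → Unique (FT G n i j)
FT-unique G n i j = filterB-unique _ (forestTriples-unique (plusPath G n j) (n + j ∸ 1))

-- The forest triples of a path, read left to right: consecutive intervals starting at a, whose
-- compositions concatenate to β.
data IntervalForest : ℕ → List ℕ → List TreeTriple → Set where
  [] : ∀ {a} → IntervalForest a [] []
  cons : ∀ {a y p β r ts} → 1 ≤ r → r ≤ y → IntervalForest (a + sum (y ∷ p)) β ts →
    IntervalForest a (y ∷ p ++ β) (intervalTriple a (y ∷ p) r ∷ ts)

rootOfFirst : List TreeTriple → ℕ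
rootOfFirst [] = 0
rootOfFirst (t ∷ _) = rr t

minVertex : TreeTriple → ℕ
minVertex t = minL (verts t)

sum-++-assoc : ∀ a α β → a + sum (α ++ β) ≡ (a + sum α) + sum β
sum-++-assoc a α β = trans (cong (a +_) (sum-++ α β)) (sym (+-assoc a (sum α) (sum β)))

minVertex-intervalTriple : ∀ a α r → 1 ≤ sum α → minVertex (intervalTriple a α r) ≡ a
minVertex-intervalTriple a α r 1≤sum = minL-nonemptyInterval (sum α) 1≤sum
  where
  minL-nonemptyInterval : ∀ s → 1 ≤ s → minL (interval a s) ≡ a
  minL-nonemptyInterval (suc L) _ = minL-interval a L

allVerts-intervalForest : ∀ {a β ts} → IntervalForest a β ts → allVerts ts ≡ interval a (sum β)
allVerts-intervalForest [] = refl
allVerts-intervalForest {a} (cons {y = y} {p} {β} {ts = ts} _ _ forest) = begin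
  interval a (sum (y ∷ p)) ++ allVerts ts ≡⟨ cong (interval a (sum (y ∷ p)) ++_) (allVerts-intervalForest forest) ⟩
  interval a (sum (y ∷ p)) ++ interval (a + sum (y ∷ p)) (sum β) ≡⟨ sym (interval-++ a (sum (y ∷ p)) (sum β)) ⟩
  interval a (sum (y ∷ p) + sum β) ≡⟨ cong (interval a) (sym (sum-++ (y ∷ p) β)) ⟩
  interval a (sum (y ∷ p ++ β)) ∎
  where open ≡-Reasoning

listT-intervalForest : ∀ {a β ts} → IntervalForest a β ts → concatMap listT ts ≡ interval a (sum β)
listT-intervalForest [] = refl
listT-intervalForest {a} (cons {y = y} {p} {β} {r} {ts} 1≤r r≤y forest) = begin
  listT (intervalTriple a (y ∷ p) r) ++ concatMap listT ts
    ≡⟨ cong₂ _++_ (listT-intervalTriple a (y ∷ p) r (sum≥1 (y ∷ p) 1≤r r≤y)) (listT-intervalForest forest) ⟩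
  interval a (sum (y ∷ p)) ++ interval (a + sum (y ∷ p)) (sum β) ≡⟨ sym (interval-++ a (sum (y ∷ p)) (sum β)) ⟩
  interval a (sum (y ∷ p) + sum β) ≡⟨ cong (interval a) (sym (sum-++ (y ∷ p) β)) ⟩
  interval a (sum (y ∷ p ++ β)) ∎
  where open ≡-Reasoning

comp-intervalForest : ∀ {a β ts} → IntervalForest a β ts → concatMap comp ts ≡ β
comp-intervalForest [] = refl
comp-intervalForest (cons {y = y} {p} _ _ forest) = cong ((y ∷ p) ++_) (comp-intervalForest forest)

length≤sum-intervalForest : ∀ {a β ts} → IntervalForest a β ts → length ts ≤ sum β
length≤sum-intervalForest [] = z≤n
length≤sum-intervalForest (cons {y = y} {p} {β} {ts = ts} 1≤r r≤y forest) =
  subst (suc (length ts) ≤_) (sym (sum-++ (y ∷ p) β)) (+-mono-≤ (sum≥1 (y ∷ p) 1≤r r≤y) (length≤sum-intervalForest forest))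

minVertex-intervalForest : ∀ {a β ts} → IntervalForest a β ts →
  All (λ t → a ≤ minVertex t) ts × AllPairs _<_ (map minVertex ts)
minVertex-intervalForest [] = [] , []
minVertex-intervalForest {a} (cons {y = y} {p} {r = r} {ts} 1≤r r≤y forest) with minVertex-intervalForest forest
... | later≥ , increasing = ≤-reflexive (sym first≡a) ∷ All.map (≤-trans (m≤m+n a _)) later≥ ,
  All.map⁺ (All.map (λ later → subst (_< _) (sym first≡a) (<-≤-trans (m<m+n a 1≤sum) later)) later≥) ∷ increasing
  where
  1≤sum = sum≥1 (y ∷ p) 1≤r r≤y
  first≡a : minVertex (intervalTriple a (y ∷ p) r) ≡ a
  first≡a = minVertex-intervalTriple a (y ∷ p) r 1≤sum

findTree-here : ∀ {v t} ts → v ∈ verts t → findTree v (t ∷ ts) ≡ just t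
findTree-here {v} {t} ts v∈ with elemB v (verts t) | elemB⁺ v∈
... | true | _ = refl

findTree-there : ∀ {v t} ts → v ∉ verts t → findTree v (t ∷ ts) ≡ findTree v ts
findTree-there {v} {t} ts v∉ = cong (if_then just t else findTree v ts) (¬T⇒≡false (v∉ ∘ elemB⁻ (verts t)))

findTree-just : ∀ {v t} ts → findTree v ts ≡ just t → t ∈ ts × v ∈ verts t
findTree-just {v} (t′ ∷ ts) found with elemB v (verts t′) in v∈t′
findTree-just {v} (t′ ∷ ts) refl | true = here refl , elemB⁻ _ (subst T (sym v∈t′) _)
... | false = let t∈ , v∈ = findTree-just ts found in there t∈ , v∈

lastD-++-∷ : ∀ d xs z zs → lastD d (xs ++ z ∷ zs) ≡ lastD z zs
lastD-++-∷ d [] z zs = refl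
lastD-++-∷ d (x ∷ xs) z zs = lastD-++-∷ x xs z zs

lastD≤sum : ∀ xs → lastD 0 xs ≤ sum xs
lastD≤sum xs = lastD≤default+sum 0 xs
  where
  lastD≤default+sum : ∀ d xs → lastD d xs ≤ d + sum xs
  lastD≤default+sum d [] = ≤-reflexive (sym (+-identityʳ d))
  lastD≤default+sum d (x ∷ xs) = ≤-trans (lastD≤default+sum x xs) (m≤n+m _ d)

lastD-++-[] : ∀ xs → lastD 0 (xs ++ []) ≡ lastD 0 xs
lastD-++-[] xs = cong (lastD 0) (++-identityʳ xs)

intervalForest-sum>0 : ∀ {a z zs ts} → IntervalForest a (z ∷ zs) ts → 1 ≤ sum (z ∷ zs)
intervalForest-sum>0 {zs = zs} (cons {y = y} 1≤r r≤y _) = ≤-trans (≤-trans 1≤r r≤y) (m≤m+n y (sum zs))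

lastD-treeOfLastVertex : ∀ {a β ts t m} → IntervalForest a β ts → a + sum β ≡ suc m → t ∈ ts → m ∈ verts t →
  lastD 0 (comp t) ≡ lastD 0 β
lastD-treeOfLastVertex {a} (cons {y = y} {p} {[]} _ _ []) _ (here refl) _ = sym (lastD-++-[] (y ∷ p))
lastD-treeOfLastVertex {a} {m = m} (cons {y = y} {p} {z ∷ zs} _ _ forest) end≡ (here refl) m∈ =
  ⊥-elim (<-irrefl refl (begin-strict
    a + S                   <⟨ m<m+n (a + S) (intervalForest-sum>0 forest) ⟩
    (a + S) + sum (z ∷ zs)  ≡⟨ trans (sym (sum-++-assoc a (y ∷ p) (z ∷ zs))) end≡ ⟩
    suc m                   ≤⟨ proj₂ (∈-interval⁻ a S m∈) ⟩
    a + S                   ∎))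
  where
  open ≤-Reasoning
  S = sum (y ∷ p)
lastD-treeOfLastVertex {a} (cons {y = y} {p} {z ∷ zs} _ _ forest) end≡ (there t∈) m∈ =
  trans (lastD-treeOfLastVertex forest (trans (sym (sum-++-assoc a (y ∷ p) (z ∷ zs))) end≡) t∈ m∈) (sym (lastD-++-∷ 0 (y ∷ p) z zs))

findTree-lastTree : ∀ {n j a β ts} → 1 ≤ j → IntervalForest a β ts → a + sum β ≡ n + j → j ≤ lastD 0 β →
  ∀ {v} → n ≤ v → v < n + j →
  ∃[ t ] (findTree v ts ≡ just t × (∀ {w} → n ≤ w → w < n + j → w ∈ verts t) × lastD 0 (comp t) ≡ lastD 0 β)
findTree-lastTree 1≤j [] _ j≤0 = ⊥-elim (<-irrefl refl (≤-trans 1≤j j≤0))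
findTree-lastTree {n} {j} {a} 1≤j (cons {y = y} {p} {[]} {r} _ _ []) end≡ j≤last {v} n≤v v<end =
  intervalTriple a (y ∷ p) r , findTree-here [] (cover n≤v v<end) , cover , sym (lastD-++-[] (y ∷ p))
  where
  S = sum (y ∷ p)
  end≡′ : a + S ≡ n + j
  end≡′ = trans (sym (trans (sum-++-assoc a (y ∷ p) []) (+-identityʳ _))) end≡
  j≤S : j ≤ S
  j≤S = ≤-trans (subst (j ≤_) (lastD-++-[] (y ∷ p)) j≤last) (lastD≤sum (y ∷ p))
  a≤n : a ≤ n
  a≤n = +-cancelʳ-≤ j a n (≤-trans (+-monoʳ-≤ a j≤S) (≤-reflexive end≡′))
  cover : ∀ {w} → n ≤ w → w < n + j → w ∈ interval a S
  cover {w} n≤w w<end = ∈-interval⁺ a S (≤-trans a≤n n≤w) (subst (w <_) (sym end≡′) w<end)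
findTree-lastTree {n} {j} {a} 1≤j (cons {y = y} {p} {z ∷ zs} {r} {ts} _ _ forest) end≡ j≤last {v} n≤v v<end
  with findTree-lastTree 1≤j forest end≡′ j≤last′ n≤v v<end
  where
  end≡′ = trans (sym (sum-++-assoc a (y ∷ p) (z ∷ zs))) end≡
  j≤last′ = subst (j ≤_) (lastD-++-∷ 0 (y ∷ p) z zs) j≤last
... | t , found , cover , last≡ = t , trans (findTree-there ts v∉first) found , cover , trans last≡ (sym (lastD-++-∷ 0 (y ∷ p) z zs))
  where
  S = sum (y ∷ p)
  firstEnd≤n : a + S ≤ n
  firstEnd≤n = +-cancelʳ-≤ j (a + S) n (≤-trans
    (+-monoʳ-≤ (a + S) (≤-trans (subst (j ≤_) (lastD-++-∷ 0 (y ∷ p) z zs) j≤last) (lastD≤sum (z ∷ zs))))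
    (≤-reflexive (trans (sym (sum-++-assoc a (y ∷ p) (z ∷ zs))) end≡)))
  v∉first : v ∉ interval a S
  v∉first v∈ = <-irrefl refl (<-≤-trans (proj₂ (∈-interval⁻ a S v∈)) (≤-trans firstEnd≤n n≤v))

record IsIntervalTriple (N a : ℕ) (α : List ℕ) (r : ℕ) : Set where
  field
    1≤a : 1 ≤ a
    fits : a + sum α ≤ suc N
    positive : All (1 ≤_) α
    1≤r : 1 ≤ r
    r≤head : r ≤ headD 0 α

record IsPath (H : Graph) (N : ℕ) : Set where
  field
    edge⇒succ : ∀ {a b} → T (H a b) → b ≡ suc a
    succ⇒edge : ∀ {a} → 1 ≤ a → suc a ≤ N → T (H a (suc a))

module PathTriples {H : Graph} {N : ℕ} (path : IsPath H N) where
  open IsPath path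

  outgoing : ℕ → List (ℕ × ℕ)
  outgoing a = map (a ,_) (filterB (H a) (range (suc a) N))

  outgoing-last : ∀ a → N ∸ a ≡ 0 → outgoing a ≡ []
  outgoing-last a N∸a≡0 rewrite range≡interval (suc a) N | N∸a≡0 = refl

  outgoing-inner : ∀ a m → 1 ≤ a → N ∸ a ≡ suc m → outgoing a ≡ (a , suc a) ∷ []
  outgoing-inner a m 1≤a N∸a≡1+m rewrite range≡interval (suc a) N | N∸a≡1+m =
    cong (map (a ,_)) (trans (filterB-accept (H a) {xs = interval (suc (suc a)) m} (succ⇒edge 1≤a a<N))
      (cong (suc a ∷_) (filterB-none (H a) (All.tabulate (λ {b} b∈ ab∈H →
        <-irrefl (sym (edge⇒succ ab∈H)) (proj₁ (∈-interval⁻ (suc (suc a)) m b∈)))))))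
    where
    a<N : suc a ≤ N
    a<N = m∸n≢0⇒n<m (λ N∸a≡0 → 0≢1+n (trans (sym N∸a≡0) N∸a≡1+m))

  N∸a≡L : ∀ a L → a + suc L ≡ suc N → N ∸ a ≡ L
  N∸a≡L a L a+1+L≡1+N = trans (cong (_∸ a) (suc-injective (trans (sym a+1+L≡1+N) (+-suc a L)))) (m+n∸m≡n a L)

  edgesOf-from : ∀ a L → 1 ≤ a → a + L ≡ suc N → concatMap outgoing (interval a L) ≡ succEdges (interval a (L ∸ 1))
  edgesOf-from a zero _ _ = refl
  edgesOf-from a (suc zero) _ a+1≡1+N rewrite outgoing-last a (N∸a≡L a 0 a+1≡1+N) = refl
  edgesOf-from a (suc (suc L)) 1≤a a+L≡1+N =
    cong₂ _++_ (outgoing-inner a L 1≤a (N∸a≡L a (suc L) a+L≡1+N))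
      (edgesOf-from (suc a) (suc L) (s≤s z≤n) (trans (sym (+-suc a (suc L))) a+L≡1+N))

  edgesOf-path : edgesOf H N ≡ succEdges (interval 1 (N ∸ 1))
  edgesOf-path rewrite range≡interval 1 N = edgesOf-from 1 N (s≤s z≤n) refl

  isTreeTriple-intervalTriple : ∀ {a α r} → IsIntervalTriple N a α r → T (isTreeTriple H (intervalTriple a α r))
  isTreeTriple-intervalTriple {a} {α} {r} valid = isTreeTriple-path (sum α) (sum≥1 α 1≤r r≤head) refl fits
    where
    open IsIntervalTriple valid
    isTreeTriple-path : ∀ s → 1 ≤ s → sum α ≡ s → a + s ≤ suc N →
      T (isTreeTriple H (treeTriple (interval a s) (succEdges (interval a (s ∸ 1))) α r))
    isTreeTriple-path (suc L) _ sum≡ a+s≤ =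
      T-∧⁺ isTree-path (T-∧⁺ nbc (T-∧⁺ positiveᵇ (T-∧⁺ sizeᵇ (T-∧⁺ (≤⇒≤ᵇ 1≤r) (≤⇒≤ᵇ r≤head)))))
      where
      V = interval a (suc L)
      nbc = isNBC-succEdges V (interval a L) α r (interval-unique a (suc L))
      positiveᵇ = allB⁻ (1 ≤ᵇ_) (All.map ≤⇒≤ᵇ positive)
      sizeᵇ = ≡⇒≡ᵇ (sum α) (length V) (trans sum≡ (sym (length-interval a (suc L))))
      edge-ok : ∀ {x} → x ∈ interval a L → T ((x <ᵇ suc x) ∧ H x (suc x) ∧ elemB x V ∧ elemB (suc x) V)
      edge-ok {x} x∈ with ∈-interval⁻ a L x∈
      ... | a≤x , x<a+L = T-∧⁺ (<⇒<ᵇ (n<1+n x))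
        (T-∧⁺ (succ⇒edge (≤-trans 1≤a a≤x) (≤-pred (≤-trans (subst (suc (suc x) ≤_) (sym (+-suc a L)) (s≤s x<a+L)) a+s≤)))
        (T-∧⁺ (elemB⁺ (∈-interval⁺ a (suc L) a≤x (subst (x <_) (sym (+-suc a L)) (m<n⇒m<1+n x<a+L))))
          (elemB⁺ (∈-interval⁺ a (suc L) (m≤n⇒m≤1+n a≤x) (subst (suc x <_) (sym (+-suc a L)) (s≤s x<a+L))))))
      edges-ok : T (allB (λ e → (proj₁ e <ᵇ proj₂ e) ∧ H (proj₁ e) (proj₂ e) ∧ elemB (proj₁ e) V ∧ elemB (proj₂ e) V)
                         (succEdges (interval a L)))
      edges-ok = allB⁻ _ (All.map⁺ (All.tabulate edge-ok))
      covered : T (allB (λ v → elemB v (listT (treeTriple V (succEdges (interval a L)) α r))) V)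
      covered = allB⁻ _ {xs = V} (All.tabulate (λ {v} v∈ → elemB⁺ (subst (v ∈_) (sym (listT-interval a (suc L) α r (s≤s z≤n))) v∈)))
      edge-count : T (suc (length (succEdges (interval a L))) ≡ᵇ length V)
      edge-count = ≡⇒≡ᵇ _ _ (cong suc (trans (length-map _ (interval a L)) (trans (length-interval a L) (sym (length-interval (suc a) L)))))
      isTree-path : T (isTree H (treeTriple V (succEdges (interval a L)) α r))
      isTree-path = T-∧⁺ {anyB (λ _ → true) V} _ (T-∧⁺ edges-ok (T-∧⁺ covered edge-count))

  intervalTriple∈treeTriples : ∀ {a α r} → IsIntervalTriple N a α r → intervalTriple a α r ∈ treeTriples H N
  intervalTriple∈treeTriples {a} {α} {r} valid = ∈-filterB⁺ _
    (∈-concatMap⁺′ _ V∈ (∈-concatMap⁺′ _ Ed∈ (∈-concatMap⁺′ _ α∈ (∈-map⁺ (treeTriple V Ed α) r∈))))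
    (isTreeTriple-intervalTriple valid)
    where
    open IsIntervalTriple valid
    V = interval a (sum α)
    Ed = succEdges (interval a (sum α ∸ 1))
    1≤sum : 1 ≤ sum α
    1≤sum = sum≥1 α 1≤r r≤head
    V∈ : V ∈ sublists (range 1 N)
    V∈ = subst (λ vs → V ∈ sublists vs) (sym (range≡interval 1 N)) (∈-sublists⁺ (interval-⊆ (sum α) N 1≤a fits))
    end≤N : a + (sum α ∸ 1) ≤ 1 + (N ∸ 1)
    end≤N = ≤-trans (≤-trans (≤-reflexive (sym (+-∸-assoc a 1≤sum))) (∸-monoˡ-≤ 1 fits)) (m≤n+m∸n N 1)
    Ed∈ : Ed ∈ sublists (edgesOf H N)
    Ed∈ = subst (λ es → Ed ∈ sublists es) (sym edgesOf-path)
      (∈-sublists⁺ (Sublist.map⁺ _ (interval-⊆ (sum α ∸ 1) (N ∸ 1) 1≤a end≤N)))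
    α∈ : α ∈ compositions (length V)
    α∈ = subst (λ m → α ∈ compositions m) (sym (length-interval a (sum α))) (∈-compositions⁺ positive)
    r∈ : r ∈ range 1 (headD 0 α)
    r∈ = ∈-range⁺ 1 (headD 0 α) 1≤r r≤head

  isTree⇒interval : ∀ {V X α r} → V ⊆ interval 1 N → X ⊆ interval 1 (N ∸ 1) → All (1 ≤_) α → sum α ≡ length V →
    1 ≤ r → r ≤ headD 0 α → T (isTree H (treeTriple V (succEdges X) α r)) →
    ∃[ a ] (treeTriple V (succEdges X) α r ≡ intervalTriple a α r × IsIntervalTriple N a α r)
  isTree⇒interval {v ∷ V} {X} {α} {r} V⊆ X⊆ positive sum≡ 1≤r r≤head tree
    with T-∧⁻ (allB _ (succEdges X)) tree
  ... | edges-ok , rest with unitSteps-interval v V X (AllPairs-⊆ V⊆ (interval-increasing 1 N))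
         (AllPairs-⊆ X⊆ (interval-increasing 1 (N ∸ 1))) steps (suc-injective (trans (cong suc (sym (length-map _ X))) edge-count))
    where
    steps : UnitSteps (v ∷ V) X
    steps = All.map endpoints (All.map⁻ (allB⁺ _ _ edges-ok))
      where
      endpoints : ∀ {x} → T ((x <ᵇ suc x) ∧ H x (suc x) ∧ elemB x (v ∷ V) ∧ elemB (suc x) (v ∷ V)) →
        x ∈ v ∷ V × suc x ∈ v ∷ V
      endpoints {x} ok with T-∧⁻ (x <ᵇ suc x) ok
      ... | _ , ok′ with T-∧⁻ (H x (suc x)) ok′
      ...   | _ , ok″ with T-∧⁻ (elemB x (v ∷ V)) ok″
      ...     | x∈ , x+1∈ = elemB⁻ _ x∈ , elemB⁻ _ x+1∈
    edge-count : suc (length (succEdges X)) ≡ length (v ∷ V)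
    edge-count = ≡ᵇ⇒≡ _ _ (proj₂ (T-∧⁻ (allB _ (v ∷ V)) rest))
  ... | V≡ , X≡ = v , shape , record { 1≤a = 1≤v ; fits = fits ; positive = positive ; 1≤r = 1≤r ; r≤head = r≤head }
    where
    shape : treeTriple (v ∷ V) (succEdges X) α r ≡ intervalTriple v α r
    shape = cong₂ (λ Vs Es → treeTriple Vs (succEdges Es) α r)
      (trans V≡ (cong (interval v) (sym sum≡))) (trans X≡ (cong (λ s → interval v (s ∸ 1)) (sym sum≡)))
    1≤v : 1 ≤ v
    1≤v = proj₁ (∈-interval⁻ 1 N (Sublist.lookup V⊆ (here refl)))
    last∈ : v + length V ∈ v ∷ V
    last∈ = subst (v + length V ∈_) (sym V≡) (∈-interval⁺ v (suc (length V)) (m≤m+n v _) (+-monoʳ-< v ≤-refl))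
    fits : v + sum α ≤ suc N
    fits = subst (λ s → v + s ≤ suc N) (sym sum≡)
      (subst (_≤ suc N) (sym (+-suc v (length V))) (proj₂ (∈-interval⁻ 1 N (Sublist.lookup V⊆ last∈))))

  IntervalShaped : TreeTriple → Set
  IntervalShaped t = ∃[ a ] ∃[ y ] ∃[ p ] ∃[ r ] (t ≡ intervalTriple a (y ∷ p) r × IsIntervalTriple N a (y ∷ p) r)

  treeTriples⇒intervalTriple : ∀ {t} → t ∈ treeTriples H N → IntervalShaped t
  treeTriples⇒intervalTriple {t} t∈ with ∈-filterB⁻ _ _ t∈
  ... | t∈′ , isTT with ∈-concatMap⁻′ _ (sublists (range 1 N)) t∈′
  ... | V , V∈ , t∈V with ∈-concatMap⁻′ _ (sublists (edgesOf H N)) t∈V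
  ... | Ed , Ed∈ , t∈Ed with ∈-concatMap⁻′ _ (compositions (length V)) t∈Ed
  ... | y ∷ p , α∈ , t∈α with ∈-map⁻ (treeTriple V Ed (y ∷ p)) t∈α
  ... | r , r∈ , refl with ⊆-map⁻ _ (interval 1 (N ∸ 1)) (subst (Ed ⊆_) edgesOf-path (∈-sublists⁻ _ Ed∈))
  ... | X , refl , X⊆ with ∈-compositions⁻ (length V) α∈ | ∈-range⁻ 1 y r∈
  ... | positive , sum≡ | 1≤r , r≤y with isTree⇒interval (subst (V ⊆_) (range≡interval 1 N) (∈-sublists⁻ _ V∈)) X⊆
           positive sum≡ 1≤r r≤y (proj₁ (T-∧⁻ (isTree H (treeTriple V (succEdges X) (y ∷ p) r)) isTT))
  ... | a , shape , valid = a , y , p , r , shape , valid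

  intervalForest-treeTriples : ∀ {a β ts} → IntervalForest a β ts → All (1 ≤_) β → 1 ≤ a → a + sum β ≤ suc N →
    All (_∈ treeTriples H N) ts
  intervalForest-treeTriples [] _ _ _ = []
  intervalForest-treeTriples {a} (cons {y = y} {p} {β} 1≤r r≤y forest) positive 1≤a fits =
    intervalTriple∈treeTriples valid ∷
    intervalForest-treeTriples forest (All.++⁻ʳ (y ∷ p) positive) (≤-trans 1≤a (m≤m+n a _))
      (subst (_≤ suc N) (sum-++-assoc a (y ∷ p) β) fits)
    where
    valid : IsIntervalTriple N a (y ∷ p) _
    valid = record
      { 1≤a = 1≤a
      ; fits = ≤-trans (m≤m+n (a + sum (y ∷ p)) (sum β)) (subst (_≤ suc N) (sum-++-assoc a (y ∷ p) β) fits)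
      ; positive = All.++⁻ˡ (y ∷ p) positive
      ; 1≤r = 1≤r
      ; r≤head = r≤y
      }

  intervalForest∈forestTriples : ∀ {β ts} → IntervalForest 1 β ts → All (1 ≤_) β → sum β ≡ N → ts ∈ forestTriples H N
  intervalForest∈forestTriples {β} {ts} forest positive sum≡N = ∈-filterB⁺ (isForest N)
    (∈-concatMap⁺′ (listsOf (treeTriples H N)) (∈-range⁺ 0 N z≤n (subst (length ts ≤_) sum≡N (length≤sum-intervalForest forest)))
      (∈-listsOf⁺ (intervalForest-treeTriples forest positive ≤-refl (≤-reflexive (cong suc sum≡N)))))
    (T-∧⁺ once (T-∧⁺ inRange (strictlyIncreasing⁺ (proj₂ (minVertex-intervalForest forest)))))
    where
    verts≡ : allVerts ts ≡ interval 1 N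
    verts≡ = trans (allVerts-intervalForest forest) (cong (interval 1) sum≡N)
    once : T (allB (λ v → countB (v ≡ᵇ_) (allVerts ts) ≡ᵇ 1) (range 1 N))
    once = allB⁻ _ (All.tabulate (λ {v} v∈ → ≡⇒≡ᵇ _ _ (trans (cong (multiplicity v) verts≡)
      (multiplicity-unique (interval-unique 1 N) (subst (v ∈_) (range≡interval 1 N) v∈)))))
    inRange : T (allB (λ v → (1 ≤ᵇ v) ∧ (v ≤ᵇ N)) (allVerts ts))
    inRange = allB⁻ _ (All.tabulate (λ {v} v∈ → let 1≤v , v<1+N = ∈-interval⁻ 1 N (subst (v ∈_) verts≡ v∈)
      in T-∧⁺ (≤⇒≤ᵇ 1≤v) (≤⇒≤ᵇ (≤-pred v<1+N))))

  record PartitionsFrom (a : ℕ) (ts : List TreeTriple) : Set where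
    field
      shaped : All IntervalShaped ts
      once : ∀ v → a ≤ v → v ≤ N → multiplicity v (allVerts ts) ≡ 1
      inRange : All (λ v → a ≤ v × v ≤ N) (allVerts ts)
      sorted : AllPairs _<_ (map minVertex ts)

  minVertex≤ : ∀ {t v} → IntervalShaped t → v ∈ verts t → minVertex t ≤ v
  minVertex≤ (a , y , p , r , refl , valid) v∈ = subst (_≤ _)
    (sym (minVertex-intervalTriple a (y ∷ p) r (sum≥1 (y ∷ p) (IsIntervalTriple.1≤r valid) (IsIntervalTriple.r≤head valid))))
    (proj₁ (∈-interval⁻ a _ v∈))

  partition-start : ∀ {a b y p r ts} → PartitionsFrom a (intervalTriple b (y ∷ p) r ∷ ts) →
    IsIntervalTriple N b (y ∷ p) r → b ≡ a
  partition-start {a} {b} {y} {p} {r} {ts} part valid = ≤-antisym b≤a a≤b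
    where
    open PartitionsFrom part
    1≤sum = sum≥1 (y ∷ p) (IsIntervalTriple.1≤r valid) (IsIntervalTriple.r≤head valid)
    b∈ : b ∈ allVerts (intervalTriple b (y ∷ p) r ∷ ts)
    b∈ = ∈-++⁺ˡ (∈-interval⁺ b (sum (y ∷ p)) ≤-refl (m<m+n b 1≤sum))
    a≤b : a ≤ b
    a≤b = proj₁ (All.lookup inRange b∈)
    a∈ : a ∈ allVerts (intervalTriple b (y ∷ p) r ∷ ts)
    a∈ = multiplicity>0⁻ (allVerts (intervalTriple b (y ∷ p) r ∷ ts))
      (≤-reflexive (sym (once a ≤-refl (≤-trans a≤b (proj₂ (All.lookup inRange b∈))))))
    b≤a : b ≤ a
    b≤a with ∈-++⁻ (interval b (sum (y ∷ p))) a∈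
    ... | inj₁ a∈first = proj₁ (∈-interval⁻ b _ a∈first)
    ... | inj₂ a∈rest with ∈-concatMap⁻′ verts ts a∈rest
    ...   | t′ , t′∈ , a∈t′ = ≤-trans (<⇒≤ b<t′) (minVertex≤ (All.lookup (All.tail shaped) t′∈) a∈t′)
      where
      b<t′ : b < minVertex t′
      b<t′ = subst (_< minVertex t′) (minVertex-intervalTriple b (y ∷ p) r 1≤sum)
        (All.lookup (AllPairs.head sorted) (∈-map⁺ minVertex t′∈))

  partition-head : ∀ {a t ts} → PartitionsFrom a (t ∷ ts) →
    ∃[ y ] ∃[ p ] ∃[ r ] (t ≡ intervalTriple a (y ∷ p) r × IsIntervalTriple N a (y ∷ p) r)
  partition-head part = start (All.head (PartitionsFrom.shaped part)) part
    where
    start : ∀ {a t ts} → IntervalShaped t → PartitionsFrom a (t ∷ ts) →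
      ∃[ y ] ∃[ p ] ∃[ r ] (t ≡ intervalTriple a (y ∷ p) r × IsIntervalTriple N a (y ∷ p) r)
    start (b , y , p , r , refl , valid) part with partition-start part valid
    ... | refl = y , p , r , refl , valid

  partition-tail : ∀ {a y p r ts} → 1 ≤ sum (y ∷ p) → PartitionsFrom a (intervalTriple a (y ∷ p) r ∷ ts) →
    PartitionsFrom (a + sum (y ∷ p)) ts
  partition-tail {a} {y} {p} {r} {ts} 1≤sum part = record
    { shaped = All.tail shaped
    ; once = λ v end≤v v≤N → trans (sym (cong (_+ multiplicity v (allVerts ts)) (notInFirst end≤v)))
        (trans (sym (countB-++ (v ≡ᵇ_) (interval a S) (allVerts ts))) (once v (≤-trans (m≤m+n a S) end≤v) v≤N))
    ; inRange = All.tabulate (λ {v} v∈ → pastFirst v∈ , proj₂ (All.lookup inRange (∈-++⁺ʳ (interval a S) v∈)))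
    ; sorted = AllPairs.tail sorted
    }
    where
    open PartitionsFrom part
    S = sum (y ∷ p)
    notInFirst : ∀ {v} → a + S ≤ v → multiplicity v (interval a S) ≡ 0
    notInFirst end≤v = countB-none _ (All.tabulate (λ u∈ v≡u →
      <-irrefl (sym (≡ᵇ⇒≡ _ _ v≡u)) (<-≤-trans (proj₂ (∈-interval⁻ a S u∈)) end≤v)))
    pastFirst : ∀ {v} → v ∈ allVerts ts → a + S ≤ v
    pastFirst {v} v∈ with a + S ≤? v
    ... | yes end≤v = end≤v
    ... | no end≰v = ⊥-elim (<-irrefl refl (subst (1 <_) twice (+-mono-≤ inFirst inRest)))
      where
      bounds = All.lookup inRange (∈-++⁺ʳ (interval a S) v∈)
      twice : multiplicity v (interval a S) + multiplicity v (allVerts ts) ≡ 1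
      twice = trans (sym (countB-++ (v ≡ᵇ_) (interval a S) (allVerts ts))) (once v (proj₁ bounds) (proj₂ bounds))
      inFirst = countB>0 (v ≡ᵇ_) (∈-interval⁺ a S (proj₁ bounds) (≰⇒> end≰v)) (≡⇒≡ᵇ v v refl)
      inRest = countB>0 (v ≡ᵇ_) v∈ (≡⇒≡ᵇ v v refl)

  partition⇒intervalForest : ∀ {a} ts → PartitionsFrom a ts → a ≤ suc N →
    ∃[ β ] (IntervalForest a β ts × All (1 ≤_) β × a + sum β ≡ suc N)
  partition⇒intervalForest {a} [] part a≤1+N with a ≤? N
  ... | yes a≤N = ⊥-elim (0≢1+n (PartitionsFrom.once part a ≤-refl a≤N))
  ... | no a≰N = [] , [] , [] , trans (+-identityʳ a) (≤-antisym a≤1+N (≰⇒> a≰N))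
  partition⇒intervalForest {a} (t ∷ ts) part _ with partition-head part
  ... | y , p , r , refl , valid with partition⇒intervalForest ts (partition-tail 1≤sum part) fits
    where
    open IsIntervalTriple valid
    1≤sum = sum≥1 (y ∷ p) 1≤r r≤head
  ...   | β , forest , positive′ , end≡ = y ∷ p ++ β , cons 1≤r r≤head forest , All.++⁺ positive positive′ ,
          trans (sum-++-assoc a (y ∷ p) β) end≡
    where open IsIntervalTriple valid

  forestTriples⇒intervalForest : ∀ {ts} → ts ∈ forestTriples H N → ∃[ β ] (IntervalForest 1 β ts × All (1 ≤_) β × sum β ≡ N)
  forestTriples⇒intervalForest {ts} ts∈ with ∈-filterB⁻ (isForest N) _ ts∈
  ... | ts∈′ , forest with ∈-concatMap⁻′ (listsOf (treeTriples H N)) (range 0 N) ts∈′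
  ... | k , _ , ts∈k with partition⇒intervalForest ts (partition (proj₂ (∈-listsOf⁻ k ts∈k)) forest) (s≤s z≤n)
    where
    partition : All (_∈ treeTriples H N) ts → T (isForest N ts) → PartitionsFrom 1 ts
    partition trees forest with T-∧⁻ (allB _ (range 1 N)) forest
    ... | once , forest′ with T-∧⁻ (allB _ (allVerts ts)) forest′
    ... | inRange , sorted = record
      { shaped = All.map treeTriples⇒intervalTriple trees
      ; once = λ v 1≤v v≤N → ≡ᵇ⇒≡ _ _ (All.lookup (allB⁺ _ _ once) (∈-range⁺ 1 N 1≤v v≤N))
      ; inRange = All.map bounds (allB⁺ _ _ inRange)
      ; sorted = strictlyIncreasing⁻ _ sorted
      }
      where
      bounds : ∀ {v} → T ((1 ≤ᵇ v) ∧ (v ≤ᵇ N)) → 1 ≤ v × v ≤ N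
      bounds {v} 1≤v≤N = let 1≤ᵇv , v≤ᵇN = T-∧⁻ (1 ≤ᵇ v) 1≤v≤N in ≤ᵇ⇒≤ 1 v 1≤ᵇv , ≤ᵇ⇒≤ v N v≤ᵇN
  ... | β , forest′ , positive , 1+sum≡ = β , forest′ , positive , suc-injective 1+sum≡

-- forestsExtending a cur r xs: the first tree starts at a, has root r and composition cur followed
-- by a prefix of xs; the remaining parts of xs go to the later trees.
forestsExtending : ℕ → List ℕ → ℕ → List ℕ → List (List TreeTriple)
intervalForests : ℕ → List ℕ → List (List TreeTriple)
forestsExtending a cur r [] = (intervalTriple a cur r ∷ []) ∷ []
forestsExtending a cur r (y ∷ ys) =
  forestsExtending a (cur ++ y ∷ []) r ys ++ map (intervalTriple a cur r ∷_) (intervalForests (a + sum cur) (y ∷ ys))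
intervalForests b [] = [] ∷ []
intervalForests b (y ∷ ys) = concatMap (λ r → forestsExtending b (y ∷ []) r ys) (range 1 y)

Extends : ℕ → List ℕ → ℕ → List ℕ → List TreeTriple → Set
Extends a cur r xs ts = ∃[ p ] ∃[ β ] ∃[ ts′ ]
  (xs ≡ p ++ β × ts ≡ intervalTriple a (cur ++ p) r ∷ ts′ × IntervalForest (a + sum (cur ++ p)) β ts′)

∈-forestsExtending⁻ : ∀ a cur r xs {ts} → ts ∈ forestsExtending a cur r xs → Extends a cur r xs ts
∈-intervalForests⁻ : ∀ b β {ts} → ts ∈ intervalForests b β → IntervalForest b β ts
∈-forestsExtending⁻ a cur r [] (here refl) =
  [] , [] , [] , refl , cong (λ c → intervalTriple a c r ∷ []) (sym (++-identityʳ cur)) , []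
∈-forestsExtending⁻ a cur r (y ∷ ys) {ts} ts∈ with ∈-++⁻ (forestsExtending a (cur ++ y ∷ []) r ys) ts∈
... | inj₁ ts∈longer = grow (∈-forestsExtending⁻ a (cur ++ y ∷ []) r ys ts∈longer)
  where
  grow : Extends a (cur ++ y ∷ []) r ys ts → Extends a cur r (y ∷ ys) ts
  grow (p , β , ts′ , refl , refl , forest) = y ∷ p , β , ts′ , refl ,
    cong (λ c → intervalTriple a c r ∷ ts′) (++-assoc cur (y ∷ []) p) ,
    subst (λ c → IntervalForest (a + sum c) β ts′) (++-assoc cur (y ∷ []) p) forest
... | inj₂ ts∈closed with ∈-map⁻ (intervalTriple a cur r ∷_) ts∈closed
...   | ts′ , ts′∈ , refl = [] , y ∷ ys , ts′ , refl , cong (λ c → intervalTriple a c r ∷ ts′) (sym (++-identityʳ cur)) ,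
  subst (λ c → IntervalForest (a + sum c) (y ∷ ys) ts′) (sym (++-identityʳ cur)) (∈-intervalForests⁻ (a + sum cur) (y ∷ ys) ts′∈)
∈-intervalForests⁻ b [] (here refl) = []
∈-intervalForests⁻ b (y ∷ ys) {ts} ts∈ with ∈-concatMap⁻′ (λ r → forestsExtending b (y ∷ []) r ys) (range 1 y) ts∈
... | r , r∈ , ts∈′ with ∈-forestsExtending⁻ b (y ∷ []) r ys ts∈′
...   | p , β , ts′ , refl , refl , forest = cons (proj₁ (∈-range⁻ 1 y r∈)) (proj₂ (∈-range⁻ 1 y r∈)) forest

∈-forestsExtending⁺ : ∀ a cur r p β {ts} → ts ∈ intervalForests (a + sum (cur ++ p)) β →
  intervalTriple a (cur ++ p) r ∷ ts ∈ forestsExtending a cur r (p ++ β)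
∈-intervalForests⁺ : ∀ {b β ts} → IntervalForest b β ts → ts ∈ intervalForests b β
∈-forestsExtending⁺ a cur r [] [] (here refl) = here (cong (λ c → intervalTriple a c r ∷ []) (++-identityʳ cur))
∈-forestsExtending⁺ a cur r [] (y ∷ ys) {ts} ts∈ with cur ++ [] | ++-identityʳ cur
... | .cur | refl = ∈-++⁺ʳ (forestsExtending a (cur ++ y ∷ []) r ys) (∈-map⁺ (intervalTriple a cur r ∷_) ts∈)
∈-forestsExtending⁺ a cur r (y ∷ p) β {ts} ts∈ with (cur ++ y ∷ []) ++ p | ++-assoc cur (y ∷ []) p
  | ∈-forestsExtending⁺ a (cur ++ y ∷ []) r p β {ts}
... | .(cur ++ y ∷ p) | refl | longer = ∈-++⁺ˡ (longer ts∈)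
∈-intervalForests⁺ [] = here refl
∈-intervalForests⁺ {b} (cons {y = y} {p} {β} {r} 1≤r r≤y forest) =
  ∈-concatMap⁺′ (λ r → forestsExtending b (y ∷ []) r (p ++ β)) (∈-range⁺ 1 y 1≤r r≤y)
    (∈-forestsExtending⁺ b (y ∷ []) r p β (∈-intervalForests⁺ forest))

comp-forestsExtending : ∀ a cur r xs {ts} → ts ∈ forestsExtending a cur r xs → concatMap comp ts ≡ cur ++ xs
comp-forestsExtending a cur r xs ts∈ with ∈-forestsExtending⁻ a cur r xs ts∈
... | p , β , ts′ , refl , refl , forest = trans (cong ((cur ++ p) ++_) (comp-intervalForest forest)) (++-assoc cur p β)

firstComp : List TreeTriple → List ℕ
firstComp [] = []
firstComp (t ∷ _) = comp t

forestsExtending-unique : ∀ a cur r xs → Unique (forestsExtending a cur r xs)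
intervalForests-unique : ∀ b β → Unique (intervalForests b β)
forestsExtending-unique a cur r [] = [] ∷ []
forestsExtending-unique a cur r (y ∷ ys) =
  Unique.++⁺ (forestsExtending-unique a (cur ++ y ∷ []) r ys)
    (Unique.map⁺ ∷-injectiveʳ (intervalForests-unique (a + sum cur) (y ∷ ys))) disjoint
  where
  disjoint : ∀ {ts} → ¬ (ts ∈ forestsExtending a (cur ++ y ∷ []) r ys × ts ∈ map (intervalTriple a cur r ∷_) _)
  disjoint (ts∈longer , ts∈closed) with ∈-forestsExtending⁻ a (cur ++ y ∷ []) r ys ts∈longer | ∈-map⁻ _ ts∈closed
  ... | p , _ , _ , _ , refl , _ | _ , _ , ts≡ = <-irrefl refl (subst (length cur <_) (cong (length ∘ firstComp) ts≡) longer)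
    where
    longer : length cur < length ((cur ++ y ∷ []) ++ p)
    longer = subst (length cur <_) (sym (trans (cong length (++-assoc cur (y ∷ []) p)) (length-++ cur))) (m<m+n (length cur) z<s)
intervalForests-unique b [] = [] ∷ []
intervalForests-unique b (y ∷ ys) =
  concatMap-unique _ (range-unique 1 y) (λ r → forestsExtending-unique b (y ∷ []) r ys) sameRoot
  where
  sameRoot : ∀ {r r′ ts} → ts ∈ forestsExtending b (y ∷ []) r ys → ts ∈ forestsExtending b (y ∷ []) r′ ys → r ≡ r′
  sameRoot {r} {r′} ts∈ ts∈′ with ∈-forestsExtending⁻ b (y ∷ []) r ys ts∈ | ∈-forestsExtending⁻ b (y ∷ []) r′ ys ts∈′
  ... | _ , _ , _ , _ , refl , _ | _ , _ , _ , _ , ts≡ , _ = cong rootOfFirst ts≡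

rootWeight : List TreeTriple → ℕ
rootWeight ts = sum (map (λ t → rr t ∸ 1) ts)

signedTerm : List TreeTriple → ℕ → ℤ
signedTerm ts = coeff (monomial (sign ts) (rootWeight ts))

qProduct : List ℕ → Poly
qProduct = foldr (λ a p → polyMul (qintMinus1 a) p) (⁺ 1 ∷ [])

forestPolynomial : List ℕ → Poly
forestPolynomial [] = ⁺ 1 ∷ []
forestPolynomial (y ∷ ys) = polyMul (qint y) (qProduct ys)

signedTerm-∷ : ∀ t ts k → signedTerm (t ∷ ts) k ≡ negOnePow (length (comp t) ∸ 1) *ℤ shift (rr t ∸ 1) (signedTerm ts) k
signedTerm-∷ t ts k rewrite negOnePow-+ (length (comp t) ∸ 1) (sum (map (λ t → length (comp t) ∸ 1) ts)) =
  coeff-monomial-+ (negOnePow (length (comp t) ∸ 1)) (sign ts) (rr t ∸ 1) (rootWeight ts) k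

negOnePow-snoc : ∀ (cur : List ℕ) y → 1 ≤ length cur → negOnePow (length (cur ++ y ∷ []) ∸ 1) ≡ - negOnePow (length cur ∸ 1)
negOnePow-snoc (c ∷ cur) y _ = cong negOnePow (trans (length-++ cur) (+-comm (length cur) 1))

-- The part y either continues the current tree (sign -1) or closes it, so that y starts a new tree
-- with a free root: this is where the factor [y]_q - 1 comes from.
∑-forestsExtending-step : ∀ a cur r y ys k → 1 ≤ length cur →
  ∑ (forestsExtending a (cur ++ y ∷ []) r ys) (λ ts → signedTerm ts k) ≡
    negOnePow (length (cur ++ y ∷ []) ∸ 1) *ℤ shift (r ∸ 1) (coeff (qProduct ys)) k →
  (∀ k → ∑ (intervalForests (a + sum cur) (y ∷ ys)) (λ ts → signedTerm ts k) ≡ coeff (forestPolynomial (y ∷ ys)) k) →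
  ∑ (forestsExtending a cur r (y ∷ ys)) (λ ts → signedTerm ts k) ≡
    negOnePow (length cur ∸ 1) *ℤ shift (r ∸ 1) (coeff (qProduct (y ∷ ys))) k
∑-forestsExtending-step a cur r y ys k 1≤len ∑longer ∑closed = begin
  ∑ (longer ++ map (intervalTriple a cur r ∷_) closed) f
    ≡⟨ ∑-++ longer _ f ⟩
  ∑ longer f +ℤ ∑ (map (intervalTriple a cur r ∷_) closed) f
    ≡⟨ cong₂ _+ℤ_ continueBlock closeBlock ⟩
  - s *ℤ shift (r ∸ 1) (coeff (qProduct ys)) k +ℤ s *ℤ shift (r ∸ 1) (coeff (forestPolynomial (y ∷ ys))) k
    ≡⟨ factor s _ _ ⟩
  s *ℤ (shift (r ∸ 1) (coeff (forestPolynomial (y ∷ ys))) k +ℤ - shift (r ∸ 1) (coeff (qProduct ys)) k)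
    ≡⟨ cong (s *ℤ_) qintMinus1-step ⟩
  s *ℤ shift (r ∸ 1) (coeff (qProduct (y ∷ ys))) k ∎
  where
  open ≡-Reasoning
  f = λ ts → signedTerm ts k
  s = negOnePow (length cur ∸ 1)
  longer = forestsExtending a (cur ++ y ∷ []) r ys
  closed = intervalForests (a + sum cur) (y ∷ ys)
  factor : ∀ (s u v : ℤ) → - s *ℤ v +ℤ s *ℤ u ≡ s *ℤ (u +ℤ - v)
  factor = solve-∀
  continueBlock : ∑ longer f ≡ - s *ℤ shift (r ∸ 1) (coeff (qProduct ys)) k
  continueBlock = trans ∑longer (cong (_*ℤ shift (r ∸ 1) (coeff (qProduct ys)) k) (negOnePow-snoc cur y 1≤len))
  closeBlock : ∑ (map (intervalTriple a cur r ∷_) closed) f ≡ s *ℤ shift (r ∸ 1) (coeff (forestPolynomial (y ∷ ys))) k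
  closeBlock = begin
    ∑ (map (intervalTriple a cur r ∷_) closed) f
      ≡⟨ ∑-map _ closed f ⟩
    ∑ closed (λ ts → signedTerm (intervalTriple a cur r ∷ ts) k)
      ≡⟨ ∑-cong closed (λ {ts} _ → signedTerm-∷ (intervalTriple a cur r) ts k) ⟩
    ∑ closed (λ ts → s *ℤ shift (r ∸ 1) (signedTerm ts) k)
      ≡⟨ ∑-*ˡ closed s _ ⟩
    s *ℤ ∑ closed (λ ts → shift (r ∸ 1) (signedTerm ts) k)
      ≡⟨ cong (s *ℤ_) (∑-shift closed (r ∸ 1) signedTerm k) ⟩
    s *ℤ shift (r ∸ 1) (λ k → ∑ closed (λ ts → signedTerm ts k)) k
      ≡⟨ cong (s *ℤ_) (shift-cong (r ∸ 1) ∑closed k) ⟩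
    s *ℤ shift (r ∸ 1) (coeff (forestPolynomial (y ∷ ys))) k ∎
  qintMinus1-step : shift (r ∸ 1) (coeff (forestPolynomial (y ∷ ys))) k +ℤ - shift (r ∸ 1) (coeff (qProduct ys)) k ≡
    shift (r ∸ 1) (coeff (qProduct (y ∷ ys))) k
  qintMinus1-step = trans (shift-− (r ∸ 1) _ _ k) (shift-cong (r ∸ 1) (λ k → sym (coeff-qintMinus1-polyMul y (qProduct ys) k)) k)

∑-intervalForests-step : ∀ b y ys k →
  (∀ r → ∑ (forestsExtending b (y ∷ []) r ys) (λ ts → signedTerm ts k) ≡ ⁺ 1 *ℤ shift (r ∸ 1) (coeff (qProduct ys)) k) →
  ∑ (intervalForests b (y ∷ ys)) (λ ts → signedTerm ts k) ≡ coeff (forestPolynomial (y ∷ ys)) k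
∑-intervalForests-step b y ys k ∑extending = begin
  ∑ (concatMap (λ r → forestsExtending b (y ∷ []) r ys) (range 1 y)) f
    ≡⟨ ∑-concatMap (λ r → forestsExtending b (y ∷ []) r ys) (range 1 y) f ⟩
  ∑ (range 1 y) (λ r → ∑ (forestsExtending b (y ∷ []) r ys) f)
    ≡⟨ ∑-cong (range 1 y) (λ {r} _ → trans (∑extending r) (ℤ.*-identityˡ _)) ⟩
  ∑ (range 1 y) (λ r → shift (r ∸ 1) (coeff (qProduct ys)) k)
    ≡⟨ cong (λ rs → ∑ rs (λ r → shift (r ∸ 1) (coeff (qProduct ys)) k)) (range≡interval 1 y) ⟩
  ∑ (interval 1 y) (λ r → shift (r ∸ 1) (coeff (qProduct ys)) k)
    ≡⟨ ∑-shift≡qint y 0 (qProduct ys) k ⟩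
  coeff (forestPolynomial (y ∷ ys)) k ∎
  where
  open ≡-Reasoning
  f = λ ts → signedTerm ts k

∑-forestsExtending : ∀ a cur r xs k → 1 ≤ length cur →
  ∑ (forestsExtending a cur r xs) (λ ts → signedTerm ts k) ≡ negOnePow (length cur ∸ 1) *ℤ shift (r ∸ 1) (coeff (qProduct xs)) k
∑-intervalForests : ∀ b β k → ∑ (intervalForests b β) (λ ts → signedTerm ts k) ≡ coeff (forestPolynomial β) k
∑-forestsExtending a cur r [] k _ = trans (ℤ.+-identityʳ _) (signedTerm-∷ (intervalTriple a cur r) [] k)
∑-forestsExtending a cur r (y ∷ ys) k 1≤len = ∑-forestsExtending-step a cur r y ys k 1≤len
  (∑-forestsExtending a (cur ++ y ∷ []) r ys k (≤-trans 1≤len (subst (length cur ≤_) (sym (length-++ cur)) (m≤m+n _ _))))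
  (∑-intervalForests (a + sum cur) (y ∷ ys))
∑-intervalForests b [] k = ℤ.+-identityʳ _
∑-intervalForests b (y ∷ ys) k = ∑-intervalForests-step b y ys k (λ r → ∑-forestsExtending b (y ∷ []) r ys k (s≤s z≤n))

removeOne-insertDesc : ∀ x l → removeOne x (insertDesc x l) ≡ l
removeOne-insertDesc x [] rewrite ≡ᵇ-refl x = refl
removeOne-insertDesc x (y ∷ ys) with y ≤ᵇ x in y≤ᵇx
... | true rewrite ≡ᵇ-refl x = refl
... | false with x ≡ᵇ y in x≡ᵇy
...   | true = ⊥-elim (subst T y≤ᵇx (≤⇒≤ᵇ (≤-reflexive (sym (≡ᵇ⇒≡ x y (subst T (sym x≡ᵇy) _))))))
...   | false = cong (y ∷_) (removeOne-insertDesc x ys)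

invG-increasing : ∀ H vs → AllPairs _<_ vs → invG H vs ≡ 0
invG-increasing H [] [] = refl
invG-increasing H (v ∷ vs) (v<vs ∷ increasing) rewrite invG-increasing H vs increasing =
  trans (+-identityʳ _) (countB-none _ (All.map (λ v<w inversion → <-asym v<w (<ᵇ⇒< _ _ (proj₁ (T-∧⁻ (_ <ᵇ v) inversion)))) v<vs))

termOf : Graph → List TreeTriple → Poly × List ℕ
termOf H ts = monomial (sign ts) (weight H ts) , type′ ts

-- The summand of coeffE: coeffE terms μ k reduces to ∑ terms (coeffTerm μ k).
coeffTerm : List ℕ → ℕ → Poly × List ℕ → ℤ
coeffTerm μ k tm = if eqList (proj₂ tm) μ then coeffAt k (proj₁ tm) else ⁺ 0

coeffTerm-forestsExtending : ∀ H a i α {ts} → 1 ≤ i → ts ∈ forestsExtending a (i ∷ []) 1 α → ∀ μ k →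
  coeffTerm μ k (termOf H ts) ≡ (if eqList (sortDesc α) μ then signedTerm ts k else ⁺ 0)
coeffTerm-forestsExtending H a i α {ts} 1≤i ts∈ μ k
  with ∈-forestsExtending⁻ a (i ∷ []) 1 α ts∈ | comp-forestsExtending a (i ∷ []) 1 α ts∈
... | p , β , ts′ , refl , refl , forest | comps≡ =
  cong₂ (λ λ′ w → if eqList λ′ μ then coeffAt k (monomial (sign ts) w) else ⁺ 0) type′≡ weight≡
  where
  type′≡ : type′ ts ≡ sortDesc (p ++ β)
  type′≡ = trans (cong (removeOne i ∘ sortDesc) comps≡) (removeOne-insertDesc i (sortDesc (p ++ β)))
  listT≡ : concatMap listT ts ≡ interval a (sum (i ∷ p ++ β))
  listT≡ = listT-intervalForest (cons {p = p} ≤-refl 1≤i forest)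
  weight≡ : weight H ts ≡ rootWeight ts
  weight≡ = cong (_+ rootWeight ts) (trans (cong (invG H) listT≡) (invG-increasing H _ (interval-increasing a (sum (i ∷ p ++ β)))))

∑-coeffTerm-forestsExtending : ∀ H i α → 1 ≤ i → ∀ μ k →
  ∑ (forestsExtending 1 (i ∷ []) 1 α) (coeffTerm μ k ∘ termOf H) ≡ coeffTerm μ k (qProduct α , sortDesc α)
∑-coeffTerm-forestsExtending H i α 1≤i μ k =
  trans (∑-cong (forestsExtending 1 (i ∷ []) 1 α) (λ ts∈ → coeffTerm-forestsExtending H 1 i α 1≤i ts∈ μ k))
    (byType (eqList (sortDesc α) μ))
  where
  byType : ∀ b → ∑ (forestsExtending 1 (i ∷ []) 1 α) (λ ts → if b then signedTerm ts k else ⁺ 0) ≡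
    (if b then coeff (qProduct α) k else ⁺ 0)
  byType true = trans (∑-forestsExtending 1 (i ∷ []) 1 α k (s≤s z≤n)) (ℤ.*-identityˡ _)
  byType false = ∑-zero (forestsExtending 1 (i ∷ []) 1 α)

plusPath-isPath : ∀ n j → IsPath (plusPath (pathGraph n) n j) (n + j ∸ 1)
plusPath-isPath n j = record { edge⇒succ = edge⇒succ ; succ⇒edge = succ⇒edge }
  where
  edge⇒succ : ∀ {a b} → T (plusPath (pathGraph n) n j a b) → b ≡ suc a
  edge⇒succ {a} {b} edge with Equivalence.to (T-∨ {pathGraph n a b}) edge
  ... | inj₁ pathEdge = sym (≡ᵇ⇒≡ (suc a) b (proj₁ (T-∧⁻ (suc a ≡ᵇ b) pathEdge)))
  ... | inj₂ newEdge = sym (≡ᵇ⇒≡ (suc a) b (proj₁ (T-∧⁻ (suc a ≡ᵇ b) newEdge)))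
  succ⇒edge : ∀ {a} → 1 ≤ a → suc a ≤ n + j ∸ 1 → T (plusPath (pathGraph n) n j a (suc a))
  succ⇒edge {a} 1≤a a<N with suc a ≤? n
  ... | yes a<n = Equivalence.from T-∨ (inj₁ (T-∧⁺ (≡⇒≡ᵇ (suc a) (suc a) refl) (T-∧⁺ (≤⇒≤ᵇ 1≤a) (≤⇒≤ᵇ a<n))))
  ... | no a≮n = Equivalence.from (T-∨ {pathGraph n a (suc a)})
    (inj₂ (T-∧⁺ (≡⇒≡ᵇ (suc a) (suc a) refl) (T-∧⁺ (≤⇒≤ᵇ (≤-pred (≰⇒> a≮n))) (≤⇒≤ᵇ a<N))))

module PathPlusPath (n j : ℕ) (1≤n : 1 ≤ n) (1≤j : 1 ≤ j) where
  G : Graph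
  G = plusPath (pathGraph n) n j

  N : ℕ
  N = n + j ∸ 1

  open PathTriples (plusPath-isPath n j)

  1+N≡n+j : suc N ≡ n + j
  1+N≡n+j = m+[n∸m]≡n (≤-trans 1≤j (m≤n+m j n))

  n≤N : n ≤ N
  n≤N = ≤-pred (subst (n <_) (sym 1+N≡n+j) (subst (_≤ n + j) (+-comm n 1) (+-monoʳ-≤ n 1≤j)))

  j≤N : j ≤ N
  j≤N = ≤-pred (subst (j <_) (sym 1+N≡n+j) (+-monoˡ-≤ j 1≤n))

  record FTShape (i : ℕ) (ts : List TreeTriple) : Set where
    field
      rest : List ℕ
      forest : IntervalForest 1 (i ∷ rest) ts
      positive : All (1 ≤_) (i ∷ rest)
      size : sum (i ∷ rest) ≡ N
      root : rootOfFirst ts ≡ 1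
      lastLarge : j ≤ lastD i rest

  firstTreeOK : ℕ → Maybe TreeTriple → Bool
  firstTreeOK i nothing = false
  firstTreeOK i (just t) = (headD 0 (comp t) ≡ᵇ i) ∧ (rr t ≡ᵇ 1)

  lastTreeOK : Maybe TreeTriple → Bool
  lastTreeOK nothing = false
  lastTreeOK (just t) = allB (λ v → elemB v (verts t)) (range n N) ∧ (j ≤ᵇ lastD 0 (comp t))

  ftCond≡ : ∀ i ts → ftCond n i j ts ≡ firstTreeOK i (findTree 1 ts) ∧ lastTreeOK (findTree n ts)
  ftCond≡ i ts with findTree 1 ts | findTree n ts
  ... | nothing | _ = refl
  ... | just _ | nothing = refl
  ... | just _ | just _ = refl

  FTShape⇒FT : ∀ {i ts} → FTShape i ts → ts ∈ FT (pathGraph n) n i j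
  FTShape⇒FT {i} {ts} shape = ∈-filterB⁺ (ftCond n i j) (intervalForest∈forestTriples forest positive size)
    (subst T (sym (ftCond≡ i ts)) (T-∧⁺ (firstOK forest root) lastTreeFound))
    where
    open FTShape shape
    firstOK : ∀ {α ts} → IntervalForest 1 (i ∷ α) ts → rootOfFirst ts ≡ 1 → T (firstTreeOK i (findTree 1 ts))
    firstOK (cons {p = p} {ts = ts′} 1≤r r≤i _) refl
      rewrite findTree-here {1} {intervalTriple 1 (i ∷ p) 1} ts′ (∈-interval⁺ 1 _ ≤-refl (s≤s (sum≥1 (i ∷ p) 1≤r r≤i))) =
      T-∧⁺ (≡⇒≡ᵇ i i refl) _
    lastTreeFound : T (lastTreeOK (findTree n ts))
    lastTreeFound with findTree-lastTree 1≤j forest (trans (cong suc size) 1+N≡n+j) lastLarge ≤-refl (m<m+n n 1≤j)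
    ... | t , found , cover , last≡ rewrite found =
      T-∧⁺ (allB⁻ _ (All.tabulate (λ {v} v∈ → let n≤v , v≤N = ∈-range⁻ n N v∈
                                              in elemB⁺ (cover n≤v (subst (v <_) 1+N≡n+j (s≤s v≤N))))))
        (≤⇒≤ᵇ (subst (j ≤_) (sym last≡) lastLarge))

  forest⇒FTShape : ∀ {i β ts} → IntervalForest 1 β ts → All (1 ≤_) β → sum β ≡ N →
    T (firstTreeOK i (findTree 1 ts) ∧ lastTreeOK (findTree n ts)) → FTShape i ts
  forest⇒FTShape {i} {ts = ts} forest@(cons {y = y} {p} {rest} {r} {ts′} 1≤r r≤y forest′) positive size ok
    with T-∧⁻ ((y ≡ᵇ i) ∧ (r ≡ᵇ 1))
           (subst (λ m → T (firstTreeOK i m ∧ lastTreeOK (findTree n ts))) (findTree-here ts′ 1∈first) ok)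
    where
    1∈first = ∈-interval⁺ 1 (sum (y ∷ p)) ≤-refl (s≤s (sum≥1 (y ∷ p) 1≤r r≤y))
  ... | firstOK , lastOK′ with T-∧⁻ (y ≡ᵇ i) firstOK | findTree n ts in found
  ...   | y≡ᵇi , r≡ᵇ1 | just t
    with ≡ᵇ⇒≡ y i y≡ᵇi | ≡ᵇ⇒≡ r 1 r≡ᵇ1 | T-∧⁻ (allB (λ v → elemB v (verts t)) (range n N)) lastOK′
  ...     | refl | refl | covers , j≤ᵇlast = record
    { rest = p ++ rest ; forest = forest ; positive = positive ; size = size ; root = refl
    ; lastLarge = subst (j ≤_) (lastD-treeOfLastVertex forest (cong suc size) (proj₁ (findTree-just ts found)) N∈t)
        (≤ᵇ⇒≤ j _ j≤ᵇlast)
    }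
    where
    N∈t : N ∈ verts t
    N∈t = elemB⁻ (verts t) (All.lookup (allB⁺ _ (range n N) covers) (∈-range⁺ n N n≤N ≤-refl))

  FT⇒FTShape : ∀ {i ts} → ts ∈ FT (pathGraph n) n i j → FTShape i ts
  FT⇒FTShape {i} {ts} ts∈ = fromForest (forestTriples⇒intervalForest ts∈forests) (subst T (ftCond≡ i ts) ok)
    where
    ts∈forests = proj₁ (∈-filterB⁻ (ftCond n i j) (forestTriples G N) ts∈)
    ok = proj₂ (∈-filterB⁻ (ftCond n i j) (forestTriples G N) ts∈)
    fromForest : ∃[ β ] (IntervalForest 1 β ts × All (1 ≤_) β × sum β ≡ N) →
      T (firstTreeOK i (findTree 1 ts) ∧ lastTreeOK (findTree n ts)) → FTShape i ts
    fromForest (β , forest , positive , size) = forest⇒FTShape forest positive size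

  admissible : ℕ → List (List ℕ)
  admissible i = filterB (lastOK j) (compositions (N ∸ i))

  shapedForests : ℕ → List (List TreeTriple)
  shapedForests i = concatMap (forestsExtending 1 (i ∷ []) 1) (admissible i)

  FTShape⇒shapedForests : ∀ {i ts} → FTShape i ts → ts ∈ shapedForests i
  FTShape⇒shapedForests {i} shape with FTShape.forest shape | FTShape.root shape
  ... | cons {p = p} {β} {ts = ts′} _ _ forest′ | refl =
    ∈-concatMap⁺′ (forestsExtending 1 (i ∷ []) 1) α∈ (∈-forestsExtending⁺ 1 (i ∷ []) 1 p β (∈-intervalForests⁺ forest′))
    where
    open FTShape shape using (positive; size; lastLarge)
    sum≡ : sum (p ++ β) ≡ N ∸ i
    sum≡ = trans (sym (m+n∸m≡n i (sum (p ++ β)))) (cong (_∸ i) size)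
    lastOK⁺ : ∀ α → j ≤ lastD i α → T (lastOK j α)
    lastOK⁺ [] _ = _
    lastOK⁺ (a ∷ α) j≤last = ≤⇒≤ᵇ j≤last
    α∈ : p ++ β ∈ admissible i
    α∈ = ∈-filterB⁺ (lastOK j) (subst (λ m → p ++ β ∈ compositions m) sum≡ (∈-compositions⁺ (All.tail positive)))
      (lastOK⁺ (p ++ β) lastLarge)

  shapedForests⇒FTShape : ∀ {i ts} → 1 ≤ i → i ≤ N → ts ∈ shapedForests i → FTShape i ts
  shapedForests⇒FTShape {i} {ts} 1≤i i≤N ts∈ with ∈-concatMap⁻′ (forestsExtending 1 (i ∷ []) 1) (admissible i) ts∈
  ... | α , α∈ , ts∈α with ∈-filterB⁻ (lastOK j) _ α∈
  ... | α∈′ , α-lastOK with ∈-compositions⁻ (N ∸ i) α∈′ | ∈-forestsExtending⁻ 1 (i ∷ []) 1 α ts∈α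
  ... | positive , sum≡ | p , β , ts′ , refl , refl , forest′ = record
    { rest = p ++ β
    ; forest = cons ≤-refl 1≤i forest′
    ; positive = 1≤i ∷ positive
    ; size = trans (cong (i +_) sum≡) (m+[n∸m]≡n i≤N)
    ; root = refl
    ; lastLarge = lastOK⁻ (p ++ β) sum≡ α-lastOK
    }
    where
    lastOK⁻ : ∀ α → sum α ≡ N ∸ i → T (lastOK j α) → j ≤ lastD i α
    lastOK⁻ [] N∸i≡0 _ = subst (j ≤_) (≤-antisym (m∸n≡0⇒m≤n (sym N∸i≡0)) i≤N) j≤N
    lastOK⁻ (a ∷ α) _ j≤ᵇlast = ≤ᵇ⇒≤ j _ j≤ᵇlast

  shapedForests-unique : ∀ i → Unique (shapedForests i)
  shapedForests-unique i = concatMap-unique _ (filterB-unique (lastOK j) (compositions-unique (N ∸ i)))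
    (forestsExtending-unique 1 (i ∷ []) 1)
    (λ {α} {α′} ts∈ ts∈′ → ∷-injectiveʳ
      (trans (sym (comp-forestsExtending 1 (i ∷ []) 1 α ts∈)) (comp-forestsExtending 1 (i ∷ []) 1 α′ ts∈′)))

  ∑-FT : ∀ i → 1 ≤ i → i ≤ N → ∀ f → ∑ (FT (pathGraph n) n i j) f ≡ ∑ (shapedForests i) f
  ∑-FT i 1≤i i≤N f = ∑-sameUniqueElements f (FT-unique (pathGraph n) n i j) (shapedForests-unique i)
    (FTShape⇒shapedForests ∘ FT⇒FTShape) (FTShape⇒FT ∘ shapedForests⇒FTShape 1≤i i≤N)

  ∑-FT-empty : ∀ i → ¬ i ≤ N → ∀ f → ∑ (FT (pathGraph n) n i j) f ≡ ⁺ 0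
  ∑-FT-empty i i≰N f = ∑-sameUniqueElements f (FT-unique (pathGraph n) n i j) []
    (λ ts∈ → ⊥-elim (i≰N (i≤N (FT⇒FTShape ts∈)))) (λ ())
    where
    i≤N : ∀ {ts} → FTShape i ts → i ≤ N
    i≤N shape = subst (i ≤_) (FTShape.size shape) (m≤m+n i _)

  rhsP-admissible : ∀ i → i ≤ N → rhsP n i j ≡ map (λ α → qProduct α , sortDesc α) (admissible i)
  rhsP-admissible i i≤N = cong (λ b → if b then map (λ α → qProduct α , sortDesc α) (admissible i) else [])
    (Equivalence.to T-≡ (≤⇒≤ᵇ i≤N))

  rhsP-empty : ∀ i → ¬ i ≤ N → rhsP n i j ≡ []
  rhsP-empty i i≰N = cong (λ b → if b then map (λ α → qProduct α , sortDesc α) (admissible i) else [])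
    (¬T⇒≡false (i≰N ∘ ≤ᵇ⇒≤ i N))

proposition3p14 : (n i j : ℕ) → 1 ≤ n → 1 ≤ i → 1 ≤ j →
    (μ : List ℕ) (k : ℕ) →
    coeffE (Fentry (pathGraph n) n i j) μ k ≡ coeffE (rhsP n i j) μ k
proposition3p14 n i j 1≤n 1≤i 1≤j μ k = byRange (i ≤? N)
  where
  open PathPlusPath n j 1≤n 1≤j
  open ≡-Reasoning
  byRange : Dec (i ≤ N) → coeffE (Fentry (pathGraph n) n i j) μ k ≡ coeffE (rhsP n i j) μ k
  byRange (yes i≤N) = begin
    coeffE (Fentry (pathGraph n) n i j) μ k
      ≡⟨ ∑-map (termOf G) (FT (pathGraph n) n i j) (coeffTerm μ k) ⟩
    ∑ (FT (pathGraph n) n i j) (coeffTerm μ k ∘ termOf G)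
      ≡⟨ ∑-FT i 1≤i i≤N _ ⟩
    ∑ (shapedForests i) (coeffTerm μ k ∘ termOf G)
      ≡⟨ ∑-concatMap (forestsExtending 1 (i ∷ []) 1) (admissible i) _ ⟩
    ∑ (admissible i) (λ α → ∑ (forestsExtending 1 (i ∷ []) 1 α) (coeffTerm μ k ∘ termOf G))
      ≡⟨ ∑-cong (admissible i) (λ {α} _ → ∑-coeffTerm-forestsExtending G i α 1≤i μ k) ⟩
    ∑ (admissible i) (λ α → coeffTerm μ k (qProduct α , sortDesc α))
      ≡⟨ sym (∑-map (λ α → qProduct α , sortDesc α) (admissible i) (coeffTerm μ k)) ⟩
    coeffE (map (λ α → qProduct α , sortDesc α) (admissible i)) μ k
      ≡⟨ cong (λ terms → coeffE terms μ k) (sym (rhsP-admissible i i≤N)) ⟩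
    coeffE (rhsP n i j) μ k ∎
  byRange (no i≰N) = trans (∑-map (termOf G) (FT (pathGraph n) n i j) (coeffTerm μ k))
    (trans (∑-FT-empty i i≰N _) (cong (λ terms → coeffE terms μ k) (sym (rhsP-empty i i≰N))))
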